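{- Let $n$ be a positive integer and write $n=2^{\nu_2(n)}n_1$ with $n_1$ odd. For each $i$ with $1\le i\le \nu_2(n)$, the set $\{k\in\{1,\dots,n-1\} : k\equiv 2^{i-1}\pmod{2^i}\}$ is an independent set in $T(n)$. The vertices of $T(n)$ not contained in any of these sets are exactly $\{2^{\nu_2(n)}j : 0<j<n_1\}$, and the subgraph of $T(n)$ induced on them is isomorphic to $T(n_1)$ (via $j\mapsto 2^{\nu_2(n)}j$).
   Context: Two polynomials with integer coefficients \emph{dyadically resolve} if their resultant (over $\mathbb{Q}$) equals $\pm 2^m$ for some nonnegative integer $m$. For a positive integer $n$, $T(n)$ is the graph with vertex set $\{1,2,\dots,n-1\}$ in which distinct vertices $i,j$ are adjacent if and only if $x^n-x^i+1$ and $x^n-x^j+1$ dyadically resolve. $\nu_2(n)$ denotes the 2-adic valuation of $n$, i.e. the largest $v$ such that $2^v$ divides $n$. -}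

module Defs where

open import Data.Nat as ℕ using (ℕ; zero; suc; _∸_; _<_; _≤_; _<ᵇ_; _≡ᵇ_)
open import Data.Integer as ℤ using (ℤ; +_; -_; _*_; _+_)
open import Data.Fin using (Fin; toℕ; punchIn) renaming (zero to fz; suc to fs)
open import Data.Bool using (if_then_else_)
open import Data.Product using (∃; _×_)
open import Data.Sum using (_⊎_)
open import Relation.Binary.PropositionalEquality using (_≡_; _≢_)

sumFin : (n : ℕ) → (Fin n → ℤ) → ℤ
sumFin zero f = + 0
sumFin (suc n) f = f fz + sumFin n (λ j → f (fs j))

sgn : ℕ → ℤ
sgn zero = + 1
sgn (suc k) = - sgn k

det : (n : ℕ) → (Fin n → Fin n → ℤ) → ℤ
det zero M = + 1
det (suc n) M =
  sumFin (suc n) (λ j → sgn (toℕ j) * M fz j * det n (λ r c → M (fs r) (punchIn j c)))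

-- A polynomial is given by its degree d and coefficient function (coefficient of x^k);
-- the coefficient at index d is assumed to be the leading (nonzero) coefficient.
-- Row r < e : coefficients p_d, ..., p_0 starting at column r.
-- Row e + s : coefficients q_e, ..., q_0 starting at column s.
shiftRow : ℕ → (ℕ → ℤ) → ℕ → ℕ → ℤ
shiftRow d p r c =
  if c <ᵇ r then + 0 else (if d <ᵇ (c ∸ r) then + 0 else p (d ∸ (c ∸ r)))

sylvester : (d : ℕ) → (ℕ → ℤ) → (e : ℕ) → (ℕ → ℤ) → Fin (e ℕ.+ d) → Fin (e ℕ.+ d) → ℤ
sylvester d p e q r c =
  if toℕ r <ᵇ e then shiftRow d p (toℕ r) (toℕ c)
  else shiftRow e q (toℕ r ∸ e) (toℕ c)

resultant : (d : ℕ) → (ℕ → ℤ) → (e : ℕ) → (ℕ → ℤ) → ℤ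
resultant d p e q = det (e ℕ.+ d) (sylvester d p e q)

δ : ℕ → ℕ → ℤ
δ a b = if a ≡ᵇ b then + 1 else + 0

trinom : ℕ → ℕ → ℕ → ℤ
trinom n i k = δ k n + (- δ k i) + δ k 0

DyadicallyResolve : (d : ℕ) → (ℕ → ℤ) → (e : ℕ) → (ℕ → ℤ) → Set
DyadicallyResolve d p e q =
  ∃ λ (m : ℕ) → (resultant d p e q ≡ + (2 ℕ.^ m)) ⊎ (resultant d p e q ≡ - + (2 ℕ.^ m))

Vertex : ℕ → ℕ → Set
Vertex n k = 1 ≤ k × k < n

Adj : ℕ → ℕ → ℕ → Set
Adj n i j = i ≢ j × DyadicallyResolve n (trinom n i) n (trinom n j)

InClass : ℕ → ℕ → Set
InClass i k = ∃ λ (q : ℕ) → k ≡ q ℕ.* 2 ℕ.^ i ℕ.+ 2 ℕ.^ (i ∸ 1)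

module Submission where

-- Let k and l lie in the same class, i.e. k = 2ᵃk′ and l = 2ᵃl′ with k′, l′ odd and a < v, and write
-- n = 2ᵃN with N even. The Sylvester matrix of f(x²), g(x²) splits, after sorting rows and columns by
-- parity, into two diagonal blocks that are both the Sylvester matrix of f, g; hence substituting x²
-- for x squares the resultant, and applying this a times shows that Res(x^n - x^k + 1, x^n - x^l + 1) is
-- the 2ᵃ-th power of Res(x^N - x^k′ + 1, x^N - x^l′ + 1). Since N is even and k′, l′ are odd, both
-- trinomials take the value 3 at x = -1, so adding the alternating sum of all columns of their
-- Sylvester matrix to the last one gives a column divisible by 3: the resultant is a multiple of 3,
-- and so is never ±2^m. The same squaring identity gives the isomorphism j ↦ 2^v j onto T(n₁), and
-- the description of the remaining vertices is 2-adic bookkeeping.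

open import Defs
open import Data.Bool using (Bool; true; false; not; _xor_; if_then_else_; T)
open import Data.Empty using (⊥-elim)
open import Data.Fin using (Fin; toℕ; punchIn) renaming (zero to fzero; suc to fsuc)
open import Data.List using (List; []; _∷_; _++_; map; length; tabulate)
open import Data.List.Properties using (++-assoc; map-id; map-++; tabulate-cong)
open import Data.List.Membership.Propositional using (_∈_)
open import Data.List.Membership.Propositional.Properties using (∈-∃++; ∈-map⁺)
open import Data.List.Relation.Unary.Any as Any using ()
open import Data.Nat as ℕ using (ℕ; zero; suc; _≤_; _<_; s≤s; z≤n)
open import Data.Nat.Induction using (<-rec)
open import Data.Nat.Properties as ℕₚ using (suc-injective; <-irrefl; ≤-<-trans; ≤∧≢⇒<; m≤m+n; m≢1+n+m; ≡ᵇ⇒≡; <⇒≢)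
open import Data.Product as Product using (_,_; _×_; ∃; proj₁; proj₂)
open import Data.Sum using (_⊎_; inj₁; inj₂)
open import Data.Unit using (tt)
open import Function using (id; _∘_)
open import Function.Bundles using (_⇔_; mk⇔; Equivalence)
open import Function.Construct.Composition using (_⇔-∘_)
open import Relation.Binary.Definitions using (DecidableEquality)
open import Relation.Binary.PropositionalEquality
open import Relation.Nullary using (¬_; yes; no)

module Determinant where
  open import Data.Integer using (ℤ; +_; -_; _+_; _-_; _*_; -[1+_])
  open import Data.Integer.Properties
    using (*-identityˡ; *-zeroʳ; *-zeroˡ; *-assoc; neg-distrib-+; neg-distribʳ-*; neg-distribˡ-*; -1*i≡-i;
           +-identityˡ; +-identityʳ; +-assoc)
  open import Data.Integer.Tactic.RingSolver using (solve-∀)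
  open ≡-Reasoning

  private variable
    A R C : Set

  data Removal {A : Set} : List A → A → List A → Set where
    here  : ∀ {x xs} → Removal (x ∷ xs) x xs
    there : ∀ {x xs y ys} → Removal xs y ys → Removal (x ∷ xs) y (x ∷ ys)

  removal⇒∈ : ∀ {xs : List A} {y ys} → Removal xs y ys → y ∈ xs
  removal⇒∈ here = Any.here refl
  removal⇒∈ (there r) = Any.there (removal⇒∈ r)

  removal-⊆ : ∀ {xs : List A} {y ys} → Removal xs y ys → ∀ {z} → z ∈ ys → z ∈ xs
  removal-⊆ here z∈ = Any.there z∈
  removal-⊆ (there r) (Any.here z≡x) = Any.here z≡x
  removal-⊆ (there r) (Any.there z∈) = Any.there (removal-⊆ r z∈)

  removal-length : ∀ {xs : List A} {y ys} → Removal xs y ys → length xs ≡ suc (length ys)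
  removal-length here = refl
  removal-length (there r) = cong suc (removal-length r)

  -- Σⱼ (-1)ʲ F xⱼ (xs with its j-th entry removed)
  alternatingSum : (A → List A → ℤ) → List A → ℤ
  alternatingSum F [] = + 0
  alternatingSum F (x ∷ xs) = F x xs - alternatingSum (λ y ys → F y (x ∷ ys)) xs

  -- The minor of M on rows rs and columns cs, by Laplace expansion along the first row (0 if the lengths differ).
  detOn : (R → C → ℤ) → List R → List C → ℤ
  detOn M [] [] = + 1
  detOn M [] (_ ∷ _) = + 0
  detOn M (r ∷ rs) cs = alternatingSum (λ c cs′ → M r c * detOn M rs cs′) cs

  alternatingSum-cong : ∀ (cs : List A) {F G : A → List A → ℤ} →
    (∀ c ys → Removal cs c ys → F c ys ≡ G c ys) → alternatingSum F cs ≡ alternatingSum G cs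
  alternatingSum-cong [] eq = refl
  alternatingSum-cong (x ∷ xs) eq =
    cong₂ _-_ (eq x xs here) (alternatingSum-cong xs (λ c ys r → eq c (x ∷ ys) (there r)))

  alternatingSum-*ˡ : ∀ k (cs : List A) (F : A → List A → ℤ) →
    alternatingSum (λ c ys → k * F c ys) cs ≡ k * alternatingSum F cs
  alternatingSum-*ˡ k [] F = sym (*-zeroʳ k)
  alternatingSum-*ˡ k (x ∷ xs) F = begin
    k * F x xs - alternatingSum (λ y ys → k * F y (x ∷ ys)) xs
      ≡⟨ cong (λ s → k * F x xs - s) (alternatingSum-*ˡ k xs _) ⟩
    k * F x xs - k * alternatingSum (λ y ys → F y (x ∷ ys)) xs
      ≡⟨ *-distrib-minus k (F x xs) _ ⟩
    k * (F x xs - alternatingSum (λ y ys → F y (x ∷ ys)) xs) ∎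
    where
    *-distrib-minus : ∀ k a b → k * a - k * b ≡ k * (a - b)
    *-distrib-minus = solve-∀

  alternatingSum-neg : ∀ (cs : List A) (F : A → List A → ℤ) →
    alternatingSum (λ c ys → - F c ys) cs ≡ - alternatingSum F cs
  alternatingSum-neg cs F = begin
    alternatingSum (λ c ys → - F c ys) cs
      ≡⟨ alternatingSum-cong cs (λ c ys _ → sym (-1*i≡-i (F c ys))) ⟩
    alternatingSum (λ c ys → -[1+ 0 ] * F c ys) cs
      ≡⟨ alternatingSum-*ˡ -[1+ 0 ] cs F ⟩
    -[1+ 0 ] * alternatingSum F cs
      ≡⟨ -1*i≡-i _ ⟩
    - alternatingSum F cs ∎

  alternatingSum-+ : ∀ (cs : List A) (F G : A → List A → ℤ) →
    alternatingSum (λ c ys → F c ys + G c ys) cs ≡ alternatingSum F cs + alternatingSum G cs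
  alternatingSum-+ [] F G = refl
  alternatingSum-+ (x ∷ xs) F G = trans
    (cong (λ s → F x xs + G x xs - s) (alternatingSum-+ xs _ _))
    (interchange (F x xs) (G x xs) _ _)
    where
    interchange : ∀ a b c d → a + b - (c + d) ≡ (a - c) + (b - d)
    interchange = solve-∀

  alternatingSum-map : ∀ (g : C → A) (cs : List C) (F : A → List A → ℤ) →
    alternatingSum F (map g cs) ≡ alternatingSum (λ c ys → F (g c) (map g ys)) cs
  alternatingSum-map g [] F = refl
  alternatingSum-map g (x ∷ xs) F = cong (λ s → F (g x) (map g xs) - s) (alternatingSum-map g xs _)

  alternatingSum-swap : ∀ (a b : A) (ds bs : List A) (F : A → List A → ℤ) →
    (∀ c as es → F c (as ++ a ∷ b ∷ es) ≡ - F c (as ++ b ∷ a ∷ es)) →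
    alternatingSum F (bs ++ a ∷ b ∷ ds) ≡ - alternatingSum F (bs ++ b ∷ a ∷ ds)
  alternatingSum-swap a b ds [] F alt = begin
    F a (b ∷ ds) - (F b (a ∷ ds) - alternatingSum (λ c ys → F c (a ∷ b ∷ ys)) ds)
      ≡⟨ cong (λ s → F a (b ∷ ds) - (F b (a ∷ ds) - s))
           (trans (alternatingSum-cong ds (λ c ys _ → alt c [] ys)) (alternatingSum-neg ds _)) ⟩
    F a (b ∷ ds) - (F b (a ∷ ds) - - alternatingSum (λ c ys → F c (b ∷ a ∷ ys)) ds)
      ≡⟨ swap-first-two (F a (b ∷ ds)) (F b (a ∷ ds)) _ ⟩
    - (F b (a ∷ ds) - (F a (b ∷ ds) - alternatingSum (λ c ys → F c (b ∷ a ∷ ys)) ds)) ∎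
    where
    swap-first-two : ∀ p q e → p - (q - - e) ≡ - (q - (p - e))
    swap-first-two = solve-∀
  alternatingSum-swap a b ds (x ∷ bs) F alt = trans
    (cong₂ _-_ (alt x bs ds) (alternatingSum-swap a b ds bs _ (λ c as es → alt c (x ∷ as) es)))
    (sym (neg-distrib-minus (F x (bs ++ b ∷ a ∷ ds)) _))
    where
    neg-distrib-minus : ∀ p q → - (p - q) ≡ - p - - q
    neg-distrib-minus = solve-∀

  detOn-cong : ∀ (M N : R → C → ℤ) rs cs →
    (∀ r c → r ∈ rs → c ∈ cs → M r c ≡ N r c) → detOn M rs cs ≡ detOn N rs cs
  detOn-cong M N [] [] eq = refl
  detOn-cong M N [] (_ ∷ _) eq = refl
  detOn-cong M N (r ∷ rs) cs eq = alternatingSum-cong cs λ c ys rm →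
    cong₂ _*_ (eq r c (Any.here refl) (removal⇒∈ rm))
      (detOn-cong M N rs ys (λ r′ c′ r′∈ c′∈ → eq r′ c′ (Any.there r′∈) (removal-⊆ rm c′∈)))

  detOn-map : ∀ {R′ C′ : Set} (M : R′ → C′ → ℤ) (f : R → R′) (g : C → C′) rs cs →
    detOn M (map f rs) (map g cs) ≡ detOn (λ r c → M (f r) (g c)) rs cs
  detOn-map M f g [] [] = refl
  detOn-map M f g [] (_ ∷ _) = refl
  detOn-map M f g (r ∷ rs) cs = trans (alternatingSum-map g cs _)
    (alternatingSum-cong cs (λ c ys _ → cong (M (f r) (g c) *_) (detOn-map M f g rs ys)))

  detOn-swap : ∀ (M : R → C → ℤ) rs (a b : C) (ds bs : List C) →
    detOn M rs (bs ++ a ∷ b ∷ ds) ≡ - detOn M rs (bs ++ b ∷ a ∷ ds)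
  detOn-swap M [] a b ds [] = refl
  detOn-swap M [] a b ds (x ∷ bs) = refl
  detOn-swap M (r ∷ rs) a b ds bs = alternatingSum-swap a b ds bs _ λ c as es →
    trans (cong (M r c *_) (detOn-swap M rs a b es as)) (sym (neg-distribʳ-* (M r c) _))

  detOn-duplicate : ∀ (M : R → C → ℤ) rs (x : C) (ds bs as : List C) →
    detOn M rs (as ++ x ∷ bs ++ x ∷ ds) ≡ + 0
  detOn-duplicate M rs x ds [] as = self-negative (detOn-swap M rs x x ds as)
    where
    self-negative : ∀ {d} → d ≡ - d → d ≡ + 0
    self-negative {+ zero} _ = refl
    self-negative {+ suc _} ()
    self-negative { -[1+ _ ]} ()
  detOn-duplicate M rs x ds (y ∷ bs) as = begin
    detOn M rs (as ++ x ∷ y ∷ bs ++ x ∷ ds)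
      ≡⟨ detOn-swap M rs x y (bs ++ x ∷ ds) as ⟩
    - detOn M rs (as ++ y ∷ x ∷ bs ++ x ∷ ds)
      ≡⟨ cong (λ l → - detOn M rs l) (sym (++-assoc as (y ∷ []) (x ∷ bs ++ x ∷ ds))) ⟩
    - detOn M rs ((as ++ y ∷ []) ++ x ∷ bs ++ x ∷ ds)
      ≡⟨ cong -_ (detOn-duplicate M rs x ds bs (as ++ y ∷ [])) ⟩
    + 0 ∎

  sumFin-cong : ∀ n {f g : Fin n → ℤ} → (∀ i → f i ≡ g i) → sumFin n f ≡ sumFin n g
  sumFin-cong zero eq = refl
  sumFin-cong (suc n) eq = cong₂ _+_ (eq fzero) (sumFin-cong n (λ i → eq (fsuc i)))

  sumFin-neg : ∀ n (f : Fin n → ℤ) → sumFin n (λ i → - f i) ≡ - sumFin n f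
  sumFin-neg zero f = refl
  sumFin-neg (suc n) f =
    trans (cong (λ s → - f fzero + s) (sumFin-neg n _)) (sym (neg-distrib-+ (f fzero) _))

  sumFin-signed≡alternatingSum : ∀ {A : Set} n (g : Fin (suc n) → A) (F : A → List A → ℤ) →
    sumFin (suc n) (λ j → sgn (toℕ j) * F (g j) (tabulate (λ c → g (punchIn j c))))
      ≡ alternatingSum F (tabulate g)
  sumFin-signed≡alternatingSum zero g F =
    cong₂ _+_ (*-identityˡ (F (g fzero) [])) refl
  sumFin-signed≡alternatingSum {A} (suc n) g F =
    cong₂ _+_ (*-identityˡ (F (g fzero) (tabulate (λ i → g (fsuc i))))) (begin
    sumFin (suc n) (λ j → - sgn (toℕ j) * term′ j)
      ≡⟨ sumFin-cong (suc n) {g = λ j → - (sgn (toℕ j) * term′ j)}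
           (λ j → sym (neg-distribˡ-* (sgn (toℕ j)) (term′ j))) ⟩
    sumFin (suc n) (λ j → - (sgn (toℕ j) * term′ j))
      ≡⟨ sumFin-neg (suc n) (λ j → sgn (toℕ j) * term′ j) ⟩
    - sumFin (suc n) (λ j → sgn (toℕ j) * term′ j)
      ≡⟨ cong -_ (sumFin-signed≡alternatingSum n (λ i → g (fsuc i)) F′) ⟩
    - alternatingSum F′ (tabulate (λ i → g (fsuc i))) ∎)
    where
    F′ : A → List A → ℤ
    F′ y ys = F y (g fzero ∷ ys)
    term′ : Fin (suc n) → ℤ
    term′ j = F′ (g (fsuc j)) (tabulate (λ c → g (fsuc (punchIn j c))))

  det≡detOn : ∀ (M : R → C → ℤ) n (f : Fin n → R) (g : Fin n → C) →
    det n (λ r c → M (f r) (g c)) ≡ detOn M (tabulate f) (tabulate g)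
  det≡detOn M zero f g = refl
  det≡detOn M (suc n) f g = trans
    (sumFin-cong (suc n) λ j → trans (*-assoc (sgn (toℕ j)) (M (f fzero) (g j)) _)
       (cong (λ d → sgn (toℕ j) * (M (f fzero) (g j) * d))
          (det≡detOn M n (λ i → f (fsuc i)) (λ c → g (punchIn j c)))))
    (sumFin-signed≡alternatingSum n g (λ c ys → M (f fzero) c * detOn M (tabulate (λ i → f (fsuc i))) ys))

  module _ {C : Set} (_≟_ : DecidableEquality C) where

    occurrences : C → List C → ℕ
    occurrences L [] = 0
    occurrences L (x ∷ xs) with x ≟ L
    ... | yes _ = suc (occurrences L xs)
    ... | no _ = occurrences L xs

    occurrences≡0⇒∉ : ∀ L ys → occurrences L ys ≡ 0 → ∀ {c} → c ∈ ys → c ≢ L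
    occurrences≡0⇒∉ L (x ∷ ys) eq c∈ with x ≟ L
    occurrences≡0⇒∉ L (x ∷ ys) () c∈ | yes _
    occurrences≡0⇒∉ L (x ∷ ys) eq (Any.here refl) | no x≢L = x≢L
    occurrences≡0⇒∉ L (x ∷ ys) eq (Any.there c∈) | no _ = occurrences≡0⇒∉ L ys eq c∈

    occurrences-removal-≡ : ∀ {L cs ys} → Removal cs L ys → occurrences L cs ≡ suc (occurrences L ys)
    occurrences-removal-≡ {L} (here {x = x}) with x ≟ L
    ... | yes _ = refl
    ... | no x≢x = ⊥-elim (x≢x refl)
    occurrences-removal-≡ {L} (there {x = x} r) with x ≟ L
    ... | yes _ = cong suc (occurrences-removal-≡ r)
    ... | no _ = occurrences-removal-≡ r

    occurrences-removal-≢ : ∀ {L cs c ys} → c ≢ L → Removal cs c ys → occurrences L cs ≡ occurrences L ys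
    occurrences-removal-≢ {L} c≢L (here {x = x}) with x ≟ L
    ... | yes x≡L = ⊥-elim (c≢L x≡L)
    ... | no _ = refl
    occurrences-removal-≢ {L} c≢L (there {x = x} r) with x ≟ L
    ... | yes _ = cong suc (occurrences-removal-≢ c≢L r)
    ... | no _ = occurrences-removal-≢ c≢L r

    detOn-linear : ∀ (M₁ M₂ M : R → C → ℤ) L a b →
      (∀ r c → c ≢ L → M r c ≡ M₁ r c) → (∀ r c → c ≢ L → M r c ≡ M₂ r c) →
      (∀ r → M r L ≡ a * M₁ r L + b * M₂ r L) →
      ∀ rs cs → occurrences L cs ≡ 1 → detOn M rs cs ≡ a * detOn M₁ rs cs + b * detOn M₂ rs cs
    detOn-linear M₁ M₂ M L a b ≡M₁ ≡M₂ column-L [] [] ()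
    detOn-linear M₁ M₂ M L a b ≡M₁ ≡M₂ column-L [] (_ ∷ _) _ = sym (zero-combination a b)
      where
      zero-combination : ∀ a b → a * + 0 + b * + 0 ≡ + 0
      zero-combination = solve-∀
    detOn-linear M₁ M₂ M L a b ≡M₁ ≡M₂ column-L (r ∷ rs) cs once = begin
      alternatingSum (λ c ys → M r c * detOn M rs ys) cs
        ≡⟨ alternatingSum-cong cs expand-step ⟩
      alternatingSum (λ c ys → a * (M₁ r c * detOn M₁ rs ys) + b * (M₂ r c * detOn M₂ rs ys)) cs
        ≡⟨ alternatingSum-+ cs _ _ ⟩
      alternatingSum (λ c ys → a * (M₁ r c * detOn M₁ rs ys)) cs
        + alternatingSum (λ c ys → b * (M₂ r c * detOn M₂ rs ys)) cs
        ≡⟨ cong₂ _+_ (alternatingSum-*ˡ a cs _) (alternatingSum-*ˡ b cs _) ⟩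
      a * detOn M₁ (r ∷ rs) cs + b * detOn M₂ (r ∷ rs) cs ∎
      where
      distrib-out : ∀ a b p q d → (a * p + b * q) * d ≡ a * (p * d) + b * (q * d)
      distrib-out = solve-∀
      distrib-in : ∀ a b m p q → m * (a * p + b * q) ≡ a * (m * p) + b * (m * q)
      distrib-in = solve-∀
      expand-step : ∀ c ys → Removal cs c ys →
        M r c * detOn M rs ys ≡ a * (M₁ r c * detOn M₁ rs ys) + b * (M₂ r c * detOn M₂ rs ys)
      expand-step c ys rm with c ≟ L
      ... | yes refl = begin
        M r c * detOn M rs ys                            ≡⟨ cong (_* detOn M rs ys) (column-L r) ⟩
        (a * M₁ r c + b * M₂ r c) * detOn M rs ys        ≡⟨ distrib-out a b (M₁ r c) (M₂ r c) _ ⟩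
        a * (M₁ r c * detOn M rs ys) + b * (M₂ r c * detOn M rs ys)
          ≡⟨ cong₂ (λ u v → a * (M₁ r c * u) + b * (M₂ r c * v))
               (detOn-cong M M₁ rs ys (λ r′ c′ _ c′∈ → ≡M₁ r′ c′ (L∉ys c′∈)))
               (detOn-cong M M₂ rs ys (λ r′ c′ _ c′∈ → ≡M₂ r′ c′ (L∉ys c′∈))) ⟩
        a * (M₁ r c * detOn M₁ rs ys) + b * (M₂ r c * detOn M₂ rs ys) ∎
        where
        L∉ys : ∀ {c′} → c′ ∈ ys → c′ ≢ L
        L∉ys = occurrences≡0⇒∉ L ys (suc-injective (trans (sym (occurrences-removal-≡ rm)) once))
      ... | no c≢L = begin
        M r c * detOn M rs ys
          ≡⟨ cong (M r c *_) (detOn-linear M₁ M₂ M L a b ≡M₁ ≡M₂ column-L rs ys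
                                (trans (sym (occurrences-removal-≢ c≢L rm)) once)) ⟩
        M r c * (a * detOn M₁ rs ys + b * detOn M₂ rs ys)
          ≡⟨ distrib-in a b (M r c) _ _ ⟩
        a * (M r c * detOn M₁ rs ys) + b * (M r c * detOn M₂ rs ys)
          ≡⟨ cong₂ (λ u v → a * (u * detOn M₁ rs ys) + b * (v * detOn M₂ rs ys)) (≡M₁ r c c≢L) (≡M₂ r c c≢L) ⟩
        a * (M₁ r c * detOn M₁ rs ys) + b * (M₂ r c * detOn M₂ rs ys) ∎

  sgn-+ : ∀ a b → sgn (a ℕ.+ b) ≡ sgn a * sgn b
  sgn-+ zero b = sym (*-identityˡ (sgn b))
  sgn-+ (suc a) b = trans (cong -_ (sgn-+ a b)) (neg-distribˡ-* (sgn a) (sgn b))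

  sgn-square : ∀ a → sgn a * sgn a ≡ + 1
  sgn-square zero = refl
  sgn-square (suc a) = trans (neg-square (sgn a)) (sgn-square a)
    where
    neg-square : ∀ x → - x * - x ≡ x * x
    neg-square = solve-∀

  cancel-square : ∀ e s g r → s * s ≡ + 1 → e * g - e * s * (s * r) ≡ s * e * s * (g - r)
  cancel-square e s g r s²≡1 = begin
    e * g - e * s * (s * r)                          ≡⟨ regroup e s g r ⟩
    s * e * s * (g - r) + e * (+ 1 - s * s) * g      ≡⟨ cong (λ t → s * e * s * (g - r) + e * (+ 1 - t) * g) s²≡1 ⟩
    s * e * s * (g - r) + e * (+ 1 - + 1) * g        ≡⟨ drop-zero (s * e * s * (g - r)) e g ⟩
    s * e * s * (g - r) ∎
    where
    regroup : ∀ e s g r → e * g - e * s * (s * r) ≡ s * e * s * (g - r) + e * (+ 1 - s * s) * g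
    regroup = solve-∀
    drop-zero : ∀ a e g → a + e * (+ 1 - + 1) * g ≡ a
    drop-zero = solve-∀

  alternatingSum-sgn-length : ∀ (cs : List A) (G : A → List A → ℤ) →
    - alternatingSum (λ c zs → sgn (length zs) * G c zs) cs ≡ sgn (length cs) * alternatingSum G cs
  alternatingSum-sgn-length [] G = refl
  alternatingSum-sgn-length (y ∷ cs) G = begin
    - alternatingSum (λ c zs → sgn (length zs) * G c zs) (y ∷ cs)
      ≡⟨ cong -_ (alternatingSum-cong (y ∷ cs) (λ c zs rm →
           cong (λ k → sgn k * G c zs) (suc-injective (sym (removal-length rm))))) ⟩
    - alternatingSum (λ c zs → sgn (length cs) * G c zs) (y ∷ cs)
      ≡⟨ cong -_ (alternatingSum-*ˡ (sgn (length cs)) (y ∷ cs) G) ⟩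
    - (sgn (length cs) * alternatingSum G (y ∷ cs))
      ≡⟨ neg-distribˡ-* (sgn (length cs)) _ ⟩
    sgn (length (y ∷ cs)) * alternatingSum G (y ∷ cs) ∎

  module Colouring {A : Set} (colour : A → Bool) where

    part₀ : List A → List A
    part₀ [] = []
    part₀ (x ∷ xs) = if colour x then part₀ xs else x ∷ part₀ xs

    part₁ : List A → List A
    part₁ [] = []
    part₁ (x ∷ xs) = if colour x then x ∷ part₁ xs else part₁ xs

    -- Number of pairs in which an entry of colour true precedes one of colour false,
    -- so that sgn (inversions xs) is the sign of the shuffle xs ↦ part₀ xs ++ part₁ xs.
    inversions : List A → ℕ
    inversions [] = 0
    inversions (x ∷ xs) = if colour x then length (part₀ xs) ℕ.+ inversions xs else inversions xs

    shuffleSign : List A → ℤ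
    shuffleSign xs = sgn (inversions xs)

    module _ {x : A} (xs : List A) where
      part₀-false : colour x ≡ false → part₀ (x ∷ xs) ≡ x ∷ part₀ xs
      part₀-false eq rewrite eq = refl
      part₀-true : colour x ≡ true → part₀ (x ∷ xs) ≡ part₀ xs
      part₀-true eq rewrite eq = refl
      part₁-false : colour x ≡ false → part₁ (x ∷ xs) ≡ part₁ xs
      part₁-false eq rewrite eq = refl
      part₁-true : colour x ≡ true → part₁ (x ∷ xs) ≡ x ∷ part₁ xs
      part₁-true eq rewrite eq = refl
      shuffleSign-false : colour x ≡ false → shuffleSign (x ∷ xs) ≡ shuffleSign xs
      shuffleSign-false eq rewrite eq = refl
      shuffleSign-true : colour x ≡ true → shuffleSign (x ∷ xs) ≡ sgn (length (part₀ xs)) * shuffleSign xs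
      shuffleSign-true eq rewrite eq = sgn-+ (length (part₀ xs)) (inversions xs)

    removal-false-part₁ : ∀ {cs c ys} → Removal cs c ys → colour c ≡ false → part₁ ys ≡ part₁ cs
    removal-false-part₁ here eq rewrite eq = refl
    removal-false-part₁ (there {x = x} r) eq with colour x
    ... | true = cong (x ∷_) (removal-false-part₁ r eq)
    ... | false = removal-false-part₁ r eq

    removal-true-part₀ : ∀ {cs c ys} → Removal cs c ys → colour c ≡ true → part₀ ys ≡ part₀ cs
    removal-true-part₀ here eq rewrite eq = refl
    removal-true-part₀ (there {x = x} r) eq with colour x
    ... | false = cong (x ∷_) (removal-true-part₀ r eq)
    ... | true = removal-true-part₀ r eq

    removal-false-part₀ : ∀ {cs c ys} → Removal cs c ys → colour c ≡ false →
      length (part₀ cs) ≡ suc (length (part₀ ys))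
    removal-false-part₀ here eq rewrite eq = refl
    removal-false-part₀ (there {x = x} r) eq with colour x
    ... | false = cong suc (removal-false-part₀ r eq)
    ... | true = removal-false-part₀ r eq

    removal-true-part₁ : ∀ {cs c ys} → Removal cs c ys → colour c ≡ true →
      length (part₁ cs) ≡ suc (length (part₁ ys))
    removal-true-part₁ here eq rewrite eq = refl
    removal-true-part₁ (there {x = x} r) eq with colour x
    ... | true = cong suc (removal-true-part₁ r eq)
    ... | false = removal-true-part₁ r eq

    -- Expanding along a row of colour false in a block-diagonal matrix only sees the columns of colour false.
    alternatingSum-part₀ : ∀ cs (F G : A → List A → ℤ) →
      (∀ c ys → Removal cs c ys → colour c ≡ true → F c ys ≡ + 0) →
      (∀ c ys → Removal cs c ys → colour c ≡ false → F c ys ≡ shuffleSign ys * G c (part₀ ys)) →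
      alternatingSum F cs ≡ shuffleSign cs * alternatingSum G (part₀ cs)
    alternatingSum-part₀ [] F G F-true F-false = refl
    alternatingSum-part₀ (x ∷ xs) F G F-true F-false with colour x in eq
    ... | false = begin
      F x xs - alternatingSum (λ y ys → F y (x ∷ ys)) xs
        ≡⟨ cong₂ _-_ (F-false x xs here eq) tail-sum ⟩
      shuffleSign xs * G x (part₀ xs) - shuffleSign xs * alternatingSum (λ y ys → G y (x ∷ ys)) (part₀ xs)
        ≡⟨ *-distrib-minus (shuffleSign xs) _ _ ⟩
      shuffleSign xs * alternatingSum G (x ∷ part₀ xs) ∎
      where
      *-distrib-minus : ∀ e g b → e * g - e * b ≡ e * (g - b)
      *-distrib-minus = solve-∀
      tail-sum : alternatingSum (λ y ys → F y (x ∷ ys)) xs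
               ≡ shuffleSign xs * alternatingSum (λ y ys → G y (x ∷ ys)) (part₀ xs)
      tail-sum = alternatingSum-part₀ xs _ _
        (λ c ys r c-true → F-true c (x ∷ ys) (there r) c-true)
        (λ c ys r c-false → trans (F-false c (x ∷ ys) (there r) c-false)
          (cong₂ (λ u v → u * G c v) (shuffleSign-false ys eq) (part₀-false ys eq)))
    ... | true = begin
      F x xs - alternatingSum (λ y ys → F y (x ∷ ys)) xs
        ≡⟨ cong₂ _-_ (F-true x xs here eq) tail-sum ⟩
      + 0 - shuffleSign xs * alternatingSum G′ (part₀ xs)
        ≡⟨ cancel-sign (shuffleSign xs) _ ⟩
      shuffleSign xs * - alternatingSum G′ (part₀ xs)
        ≡⟨ cong (shuffleSign xs *_) (alternatingSum-sgn-length (part₀ xs) G) ⟩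
      shuffleSign xs * (sgn (length (part₀ xs)) * alternatingSum G (part₀ xs))
        ≡⟨ reassociate (shuffleSign xs) (sgn (length (part₀ xs))) (alternatingSum G (part₀ xs)) ⟩
      sgn (length (part₀ xs)) * shuffleSign xs * alternatingSum G (part₀ xs)
        ≡⟨ cong (_* alternatingSum G (part₀ xs)) (sym (sgn-+ (length (part₀ xs)) (inversions xs))) ⟩
      sgn (length (part₀ xs) ℕ.+ inversions xs) * alternatingSum G (part₀ xs) ∎
      where
      cancel-sign : ∀ e s → + 0 - e * s ≡ e * - s
      cancel-sign = solve-∀
      reassociate : ∀ e s g → e * (s * g) ≡ s * e * g
      reassociate = solve-∀
      G′ : A → List A → ℤ
      G′ c zs = sgn (length zs) * G c zs
      tail-sum : alternatingSum (λ y ys → F y (x ∷ ys)) xs ≡ shuffleSign xs * alternatingSum G′ (part₀ xs)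
      tail-sum = alternatingSum-part₀ xs _ G′
        (λ c ys r c-true → F-true c (x ∷ ys) (there r) c-true)
        (λ c ys r c-false → begin
          F c (x ∷ ys)
            ≡⟨ F-false c (x ∷ ys) (there r) c-false ⟩
          shuffleSign (x ∷ ys) * G c (part₀ (x ∷ ys))
            ≡⟨ cong₂ _*_ (shuffleSign-true ys eq) (cong (G c) (part₀-true ys eq)) ⟩
          sgn (length (part₀ ys)) * shuffleSign ys * G c (part₀ ys)
            ≡⟨ reassociate′ (sgn (length (part₀ ys))) (shuffleSign ys) _ ⟩
          shuffleSign ys * G′ c (part₀ ys) ∎)
        where
        reassociate′ : ∀ s e g → s * e * g ≡ e * (s * g)
        reassociate′ = solve-∀

    alternatingSum-part₁ : ∀ cs (F G : A → List A → ℤ) →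
      (∀ c ys → Removal cs c ys → colour c ≡ false → F c ys ≡ + 0) →
      (∀ c ys → Removal cs c ys → colour c ≡ true → F c ys ≡ shuffleSign ys * G c (part₁ ys)) →
      alternatingSum F cs ≡ shuffleSign cs * sgn (length (part₀ cs)) * alternatingSum G (part₁ cs)
    alternatingSum-part₁ [] F G F-false F-true = refl
    alternatingSum-part₁ (x ∷ xs) F G F-false F-true with colour x in eq
    ... | false = begin
      F x xs - alternatingSum (λ y ys → F y (x ∷ ys)) xs
        ≡⟨ cong₂ _-_ (F-false x xs here eq) tail-sum ⟩
      + 0 - shuffleSign xs * sgn (length (part₀ xs)) * alternatingSum G (part₁ xs)
        ≡⟨ move-sign (shuffleSign xs) (sgn (length (part₀ xs))) _ ⟩
      shuffleSign xs * sgn (suc (length (part₀ xs))) * alternatingSum G (part₁ xs) ∎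
      where
      move-sign : ∀ e s g → + 0 - e * s * g ≡ e * - s * g
      move-sign = solve-∀
      tail-sum : alternatingSum (λ y ys → F y (x ∷ ys)) xs
               ≡ shuffleSign xs * sgn (length (part₀ xs)) * alternatingSum G (part₁ xs)
      tail-sum = alternatingSum-part₁ xs _ G
        (λ c ys r c-false → F-false c (x ∷ ys) (there r) c-false)
        (λ c ys r c-true → trans (F-true c (x ∷ ys) (there r) c-true)
          (cong₂ (λ u v → u * G c v) (shuffleSign-false ys eq) (part₁-false ys eq)))
    ... | true = begin
      F x xs - alternatingSum (λ y ys → F y (x ∷ ys)) xs
        ≡⟨ cong₂ _-_ (F-true x xs here eq) tail-sum ⟩
      e * g - e * s * alternatingSum (λ c zs → s * G c (x ∷ zs)) (part₁ xs)
        ≡⟨ cong (λ t → e * g - e * s * t) (alternatingSum-*ˡ s (part₁ xs) _) ⟩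
      e * g - e * s * (s * rest)
        ≡⟨ cancel-square e s g rest (sgn-square (length (part₀ xs))) ⟩
      s * e * s * (g - rest)
        ≡⟨ cong (λ t → t * s * (g - rest)) (sym (sgn-+ (length (part₀ xs)) (inversions xs))) ⟩
      sgn (length (part₀ xs) ℕ.+ inversions xs) * s * (g - rest) ∎
      where
      e s g rest : ℤ
      e = shuffleSign xs
      s = sgn (length (part₀ xs))
      g = G x (part₁ xs)
      rest = alternatingSum (λ y ys → G y (x ∷ ys)) (part₁ xs)
      tail-sum : alternatingSum (λ y ys → F y (x ∷ ys)) xs
               ≡ e * s * alternatingSum (λ c zs → s * G c (x ∷ zs)) (part₁ xs)
      tail-sum = alternatingSum-part₁ xs _ _
        (λ c ys r c-false → F-false c (x ∷ ys) (there r) c-false)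
        (λ c ys r c-true → begin
          F c (x ∷ ys)
            ≡⟨ F-true c (x ∷ ys) (there r) c-true ⟩
          shuffleSign (x ∷ ys) * G c (part₁ (x ∷ ys))
            ≡⟨ cong₂ _*_ (shuffleSign-true ys eq) (cong (G c) (part₁-true ys eq)) ⟩
          sgn (length (part₀ ys)) * shuffleSign ys * G c (x ∷ part₁ ys)
            ≡⟨ cong (λ k → sgn (length k) * shuffleSign ys * G c (x ∷ part₁ ys)) (removal-true-part₀ r c-true) ⟩
          s * shuffleSign ys * G c (x ∷ part₁ ys)
            ≡⟨ reassociate s (shuffleSign ys) _ ⟩
          shuffleSign ys * (s * G c (x ∷ part₁ ys)) ∎)
        where
        reassociate : ∀ s e g → s * e * g ≡ e * (s * g)
        reassociate = solve-∀

  module _ {R C : Set} (M : R → C → ℤ) (colourR : R → Bool) (colourC : C → Bool)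
    (vanish₁₀ : ∀ r c → colourR r ≡ true → colourC c ≡ false → M r c ≡ + 0)
    (vanish₀₁ : ∀ r c → colourR r ≡ false → colourC c ≡ true → M r c ≡ + 0) where
    private
      module CR = Colouring colourR
      module CC = Colouring colourC

    SameShape : List R → List C → Set
    SameShape rs cs = length (CR.part₀ rs) ≡ length (CC.part₀ cs) × length (CR.part₁ rs) ≡ length (CC.part₁ cs)

    BlockFactorisation : List R → List C → Set
    BlockFactorisation rs cs =
      detOn M rs cs ≡ CR.shuffleSign rs * CC.shuffleSign cs
                        * (detOn M (CR.part₀ rs) (CC.part₀ cs) * detOn M (CR.part₁ rs) (CC.part₁ cs))

    private
      pull-sign : ∀ m e f a b → m * (e * f * (a * b)) ≡ f * (m * (e * (a * b)))
      pull-sign = solve-∀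

      expand-row₀ : ∀ r rs cs → colourR r ≡ false →
        suc (length (CR.part₀ rs)) ≡ length (CC.part₀ cs) × length (CR.part₁ rs) ≡ length (CC.part₁ cs) →
        (∀ ys → SameShape rs ys → BlockFactorisation rs ys) →
        detOn M (r ∷ rs) cs ≡ CR.shuffleSign rs * CC.shuffleSign cs
                                * (detOn M (r ∷ CR.part₀ rs) (CC.part₀ cs) * detOn M (CR.part₁ rs) (CC.part₁ cs))
      expand-row₀ r rs cs r-false (size₀ , size₁) factorise = begin
        detOn M (r ∷ rs) cs
          ≡⟨ CC.alternatingSum-part₀ cs _ G
               (λ c ys _ c-true → trans (cong (_* detOn M rs ys) (vanish₀₁ r c r-false c-true)) (*-zeroˡ (detOn M rs ys)))
               minor ⟩
        CC.shuffleSign cs * alternatingSum G (CC.part₀ cs)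
          ≡⟨ cong (CC.shuffleSign cs *_)
               (trans (alternatingSum-cong (CC.part₀ cs) (λ c zs _ → regroup (M r c) e (detOn M (CR.part₀ rs) zs) D₁))
                      (alternatingSum-*ˡ (e * D₁) (CC.part₀ cs) (λ c zs → M r c * detOn M (CR.part₀ rs) zs))) ⟩
        CC.shuffleSign cs * (e * D₁ * detOn M (r ∷ CR.part₀ rs) (CC.part₀ cs))
          ≡⟨ regroup′ (CC.shuffleSign cs) e D₁ _ ⟩
        e * CC.shuffleSign cs * (detOn M (r ∷ CR.part₀ rs) (CC.part₀ cs) * D₁) ∎
        where
        e D₁ : ℤ
        e = CR.shuffleSign rs
        D₁ = detOn M (CR.part₁ rs) (CC.part₁ cs)
        G : C → List C → ℤ
        G c zs = M r c * (e * (detOn M (CR.part₀ rs) zs * D₁))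
        regroup : ∀ m e a d → m * (e * (a * d)) ≡ e * d * (m * a)
        regroup = solve-∀
        regroup′ : ∀ f e d X → f * (e * d * X) ≡ e * f * (X * d)
        regroup′ = solve-∀
        minor : ∀ c ys → Removal cs c ys → colourC c ≡ false →
          M r c * detOn M rs ys ≡ CC.shuffleSign ys * G c (CC.part₀ ys)
        minor c ys rm c-false = begin
          M r c * detOn M rs ys
            ≡⟨ cong (M r c *_) (factorise ys
                 ( suc-injective (trans size₀ (CC.removal-false-part₀ rm c-false))
                 , trans size₁ (cong length (sym (CC.removal-false-part₁ rm c-false))))) ⟩
          M r c * (e * CC.shuffleSign ys * (detOn M (CR.part₀ rs) (CC.part₀ ys) * detOn M (CR.part₁ rs) (CC.part₁ ys)))
            ≡⟨ cong (λ l → M r c * (e * CC.shuffleSign ys * (detOn M (CR.part₀ rs) (CC.part₀ ys) * detOn M (CR.part₁ rs) l)))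
                 (CC.removal-false-part₁ rm c-false) ⟩
          M r c * (e * CC.shuffleSign ys * (detOn M (CR.part₀ rs) (CC.part₀ ys) * D₁))
            ≡⟨ pull-sign (M r c) e (CC.shuffleSign ys) (detOn M (CR.part₀ rs) (CC.part₀ ys)) D₁ ⟩
          CC.shuffleSign ys * G c (CC.part₀ ys) ∎

      expand-row₁ : ∀ r rs cs → colourR r ≡ true →
        length (CR.part₀ rs) ≡ length (CC.part₀ cs) × suc (length (CR.part₁ rs)) ≡ length (CC.part₁ cs) →
        (∀ ys → SameShape rs ys → BlockFactorisation rs ys) →
        detOn M (r ∷ rs) cs ≡ sgn (length (CR.part₀ rs) ℕ.+ CR.inversions rs) * CC.shuffleSign cs
                                * (detOn M (CR.part₀ rs) (CC.part₀ cs) * detOn M (r ∷ CR.part₁ rs) (CC.part₁ cs))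
      expand-row₁ r rs cs r-true (size₀ , size₁) factorise = begin
        detOn M (r ∷ rs) cs
          ≡⟨ CC.alternatingSum-part₁ cs _ G
               (λ c ys _ c-false → trans (cong (_* detOn M rs ys) (vanish₁₀ r c r-true c-false)) (*-zeroˡ (detOn M rs ys)))
               minor ⟩
        CC.shuffleSign cs * s * alternatingSum G (CC.part₁ cs)
          ≡⟨ cong (CC.shuffleSign cs * s *_)
               (trans (alternatingSum-cong (CC.part₁ cs) (λ c zs _ → regroup (M r c) e D₀ (detOn M (CR.part₁ rs) zs)))
                      (alternatingSum-*ˡ (e * D₀) (CC.part₁ cs) (λ c zs → M r c * detOn M (CR.part₁ rs) zs))) ⟩
        CC.shuffleSign cs * s * (e * D₀ * detOn M (r ∷ CR.part₁ rs) (CC.part₁ cs))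
          ≡⟨ regroup′ (CC.shuffleSign cs) s e D₀ _ ⟩
        s * e * CC.shuffleSign cs * (D₀ * detOn M (r ∷ CR.part₁ rs) (CC.part₁ cs))
          ≡⟨ cong (λ k → k * CC.shuffleSign cs * (D₀ * detOn M (r ∷ CR.part₁ rs) (CC.part₁ cs)))
               (trans (cong (λ k → sgn k * e) (sym size₀)) (sym (sgn-+ (length (CR.part₀ rs)) (CR.inversions rs)))) ⟩
        sgn (length (CR.part₀ rs) ℕ.+ CR.inversions rs) * CC.shuffleSign cs * (D₀ * detOn M (r ∷ CR.part₁ rs) (CC.part₁ cs)) ∎
        where
        e s D₀ : ℤ
        e = CR.shuffleSign rs
        s = sgn (length (CC.part₀ cs))
        D₀ = detOn M (CR.part₀ rs) (CC.part₀ cs)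
        G : C → List C → ℤ
        G c zs = M r c * (e * (D₀ * detOn M (CR.part₁ rs) zs))
        regroup : ∀ m e d a → m * (e * (d * a)) ≡ e * d * (m * a)
        regroup = solve-∀
        regroup′ : ∀ f s e d X → f * s * (e * d * X) ≡ s * e * f * (d * X)
        regroup′ = solve-∀
        minor : ∀ c ys → Removal cs c ys → colourC c ≡ true →
          M r c * detOn M rs ys ≡ CC.shuffleSign ys * G c (CC.part₁ ys)
        minor c ys rm c-true = begin
          M r c * detOn M rs ys
            ≡⟨ cong (M r c *_) (factorise ys
                 ( trans size₀ (cong length (sym (CC.removal-true-part₀ rm c-true)))
                 , suc-injective (trans size₁ (CC.removal-true-part₁ rm c-true)))) ⟩
          M r c * (e * CC.shuffleSign ys * (detOn M (CR.part₀ rs) (CC.part₀ ys) * detOn M (CR.part₁ rs) (CC.part₁ ys)))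
            ≡⟨ cong (λ l → M r c * (e * CC.shuffleSign ys * (detOn M (CR.part₀ rs) l * detOn M (CR.part₁ rs) (CC.part₁ ys))))
                 (CC.removal-true-part₀ rm c-true) ⟩
          M r c * (e * CC.shuffleSign ys * (D₀ * detOn M (CR.part₁ rs) (CC.part₁ ys)))
            ≡⟨ pull-sign (M r c) e (CC.shuffleSign ys) D₀ (detOn M (CR.part₁ rs) (CC.part₁ ys)) ⟩
          CC.shuffleSign ys * G c (CC.part₁ ys) ∎

    detOn-blockDiagonal : ∀ rs cs → SameShape rs cs → BlockFactorisation rs cs
    detOn-blockDiagonal [] [] _ = refl
    detOn-blockDiagonal [] (c ∷ cs) shape with colourC c
    detOn-blockDiagonal [] (c ∷ cs) (() , _) | false
    detOn-blockDiagonal [] (c ∷ cs) (_ , ()) | true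
    detOn-blockDiagonal (r ∷ rs) cs shape with colourR r in r-colour
    ... | false = expand-row₀ r rs cs r-colour shape (detOn-blockDiagonal rs)
    ... | true = expand-row₁ r rs cs r-colour shape (detOn-blockDiagonal rs)

  detOn-repeated : ∀ (M : R → C → ℤ) rs {c xs} ys → c ∈ xs → detOn M rs (xs ++ c ∷ ys) ≡ + 0
  detOn-repeated M rs {c} ys c∈xs with ∈-∃++ c∈xs
  ... | as , bs , refl = trans (cong (detOn M rs) (++-assoc as (c ∷ bs) (c ∷ ys))) (detOn-duplicate M rs c ys bs as)

  interval : ℕ → ℕ → List ℕ
  interval s zero = []
  interval s (suc n) = s ∷ interval (suc s) n

  interval-snoc : ∀ s n → interval s (suc n) ≡ interval s n ++ (s ℕ.+ n) ∷ []
  interval-snoc s zero = cong (_∷ []) (sym (ℕₚ.+-identityʳ s))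
  interval-snoc s (suc n) = cong (s ∷_) (trans (interval-snoc (suc s) n) (cong (λ z → interval (suc s) n ++ z ∷ []) (sym (ℕₚ.+-suc s n))))

  ∈-interval⁺ : ∀ {d} s n → s ≤ d → d < s ℕ.+ n → d ∈ interval s n
  ∈-interval⁺ s zero s≤d d<s+0 = ⊥-elim (<-irrefl refl (≤-<-trans s≤d (subst (_ <_) (ℕₚ.+-identityʳ s) d<s+0)))
  ∈-interval⁺ {d} s (suc n) s≤d d<s+n with s ℕ.≟ d
  ... | yes refl = Any.here refl
  ... | no s≢d = Any.there (∈-interval⁺ (suc s) n (≤∧≢⇒< s≤d s≢d) (subst (d <_) (ℕₚ.+-suc s n) d<s+n))

  ∈-interval⁻ : ∀ {d} s n → d ∈ interval s n → d < s ℕ.+ n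
  ∈-interval⁻ s (suc n) (Any.here refl) = subst (s <_) (sym (ℕₚ.+-suc s n)) (s≤s (m≤m+n s n))
  ∈-interval⁻ {d} s (suc n) (Any.there d∈) = subst (d <_) (sym (ℕₚ.+-suc s n)) (∈-interval⁻ (suc s) n d∈)

  occurrences-interval : ∀ s n → occurrences ℕ._≟_ (s ℕ.+ n) (interval s (suc n)) ≡ 1
  occurrences-interval s zero with s ℕ.≟ s ℕ.+ 0
  ... | yes _ = refl
  ... | no s≢s+0 = ⊥-elim (s≢s+0 (sym (ℕₚ.+-identityʳ s)))
  occurrences-interval s (suc n) with s ℕ.≟ s ℕ.+ suc n
  ... | yes s≡s+1+n = ⊥-elim (m≢1+n+m s (trans s≡s+1+n (trans (ℕₚ.+-suc s n) (cong suc (ℕₚ.+-comm s n)))))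
  ... | no _ = trans (cong (λ L → occurrences ℕ._≟_ L (interval (suc s) (suc n))) (ℕₚ.+-suc s n))
                     (occurrences-interval (suc s) n)

  sumOver : List A → (A → ℤ) → ℤ
  sumOver [] f = + 0
  sumOver (x ∷ xs) f = f x + sumOver xs f

  sumOver-cong : ∀ (xs : List A) {f g : A → ℤ} → (∀ x → x ∈ xs → f x ≡ g x) → sumOver xs f ≡ sumOver xs g
  sumOver-cong [] eq = refl
  sumOver-cong (x ∷ xs) eq = cong₂ _+_ (eq x (Any.here refl)) (sumOver-cong xs (λ y y∈ → eq y (Any.there y∈)))

  sumOver-++ : ∀ (xs ys : List A) f → sumOver (xs ++ ys) f ≡ sumOver xs f + sumOver ys f
  sumOver-++ [] ys f = sym (+-identityˡ (sumOver ys f))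
  sumOver-++ (x ∷ xs) ys f = trans (cong (λ t → f x + t) (sumOver-++ xs ys f)) (sym (+-assoc (f x) _ _))

  sumOver-+ : ∀ (xs : List A) f g → sumOver xs (λ x → f x + g x) ≡ sumOver xs f + sumOver xs g
  sumOver-+ [] f g = refl
  sumOver-+ (x ∷ xs) f g = trans (cong (λ t → f x + g x + t) (sumOver-+ xs f g)) (interchange (f x) (g x) _ _)
    where
    interchange : ∀ a b c d → a + b + (c + d) ≡ a + c + (b + d)
    interchange = solve-∀

  sumOver-neg : ∀ (xs : List A) f → sumOver xs (λ x → - f x) ≡ - sumOver xs f
  sumOver-neg [] f = refl
  sumOver-neg (x ∷ xs) f = trans (cong (λ t → - f x + t) (sumOver-neg xs f)) (sym (neg-distrib-+ (f x) _))

  sumOver-zero : ∀ (xs : List A) {f} → (∀ x → x ∈ xs → f x ≡ + 0) → sumOver xs f ≡ + 0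
  sumOver-zero [] eq = refl
  sumOver-zero (x ∷ xs) eq = cong₂ _+_ (eq x (Any.here refl)) (sumOver-zero xs (λ y y∈ → eq y (Any.there y∈)))

  ≡ᵇ-refl : ∀ n → (n ℕ.≡ᵇ n) ≡ true
  ≡ᵇ-refl zero = refl
  ≡ᵇ-refl (suc n) = ≡ᵇ-refl n

  ≢⇒≡ᵇ≡false : ∀ {m n} → m ≢ n → (m ℕ.≡ᵇ n) ≡ false
  ≢⇒≡ᵇ≡false {m} {n} m≢n with m ℕ.≡ᵇ n in eq
  ... | true = ⊥-elim (m≢n (≡ᵇ⇒≡ m n (subst T (sym eq) tt)))
  ... | false = refl

  replaceColumn : ℕ → (R → ℤ) → (R → ℕ → ℤ) → R → ℕ → ℤ
  replaceColumn L v M r c = if c ℕ.≡ᵇ L then v r else M r c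

  replaceColumn-≡ : ∀ L (v : R → ℤ) M r → replaceColumn L v M r L ≡ v r
  replaceColumn-≡ L v M r rewrite ≡ᵇ-refl L = refl

  replaceColumn-≢ : ∀ {L c} (v : R → ℤ) M r → c ≢ L → replaceColumn L v M r c ≡ M r c
  replaceColumn-≢ v M r c≢L rewrite ≢⇒≡ᵇ≡false c≢L = refl

  module _ (M : R → ℕ → ℤ) (L : ℕ) (rs : List R) (cs : List ℕ) (once : occurrences ℕ._≟_ L cs ≡ 1) where

    private
      agree-off-L : ∀ (u v : R → ℤ) r c → c ≢ L → replaceColumn L u M r c ≡ replaceColumn L v M r c
      agree-off-L u v r c c≢L = trans (replaceColumn-≢ u M r c≢L) (sym (replaceColumn-≢ v M r c≢L))

    detOn-replaceColumn-* : ∀ k v →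
      detOn (replaceColumn L (λ r → k * v r) M) rs cs ≡ k * detOn (replaceColumn L v M) rs cs
    detOn-replaceColumn-* k v = begin
      detOn (replaceColumn L kv M) rs cs
        ≡⟨ detOn-linear ℕ._≟_ (replaceColumn L v M) M (replaceColumn L kv M) L k (+ 0)
             (agree-off-L kv v) (λ r c c≢L → replaceColumn-≢ kv M r c≢L) column-L rs cs once ⟩
      k * detOn (replaceColumn L v M) rs cs + + 0 * detOn M rs cs
        ≡⟨ cong (λ t → k * detOn (replaceColumn L v M) rs cs + t) (*-zeroˡ (detOn M rs cs)) ⟩
      k * detOn (replaceColumn L v M) rs cs + + 0
        ≡⟨ +-identityʳ _ ⟩
      k * detOn (replaceColumn L v M) rs cs ∎
      where
      kv : R → ℤ
      kv r = k * v r
      column-L : ∀ r → replaceColumn L kv M r L ≡ k * replaceColumn L v M r L + + 0 * M r L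
      column-L r = begin
        replaceColumn L kv M r L                  ≡⟨ replaceColumn-≡ L kv M r ⟩
        k * v r                                   ≡⟨ cong (k *_) (sym (replaceColumn-≡ L v M r)) ⟩
        k * replaceColumn L v M r L               ≡⟨ sym (+-identityʳ _) ⟩
        k * replaceColumn L v M r L + + 0         ≡⟨ cong (λ t → k * replaceColumn L v M r L + t) (sym (*-zeroˡ (M r L))) ⟩
        k * replaceColumn L v M r L + + 0 * M r L ∎

    detOn-replaceColumn-sum : ∀ ds (w : ℕ → ℤ) →
      detOn (replaceColumn L (λ r → sumOver ds (λ d → w d * M r d)) M) rs cs
        ≡ sumOver ds (λ d → w d * detOn (replaceColumn L (λ r → M r d) M) rs cs)
    detOn-replaceColumn-sum [] w = begin
      detOn Z rs cs
        ≡⟨ detOn-linear ℕ._≟_ Z Z Z L (+ 0) (+ 0) (λ _ _ _ → refl) (λ _ _ _ → refl)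
             (λ r → replaceColumn-≡ L (λ _ → + 0) M r) rs cs once ⟩
      + 0 * detOn Z rs cs + + 0 * detOn Z rs cs
        ≡⟨ cong₂ _+_ (*-zeroˡ (detOn Z rs cs)) (*-zeroˡ (detOn Z rs cs)) ⟩
      + 0 ∎
      where
      Z : R → ℕ → ℤ
      Z = replaceColumn L (λ _ → + 0) M
    detOn-replaceColumn-sum (d ∷ ds) w = begin
      detOn (replaceColumn L (λ r → w d * column-d r + rest r) M) rs cs
        ≡⟨ detOn-linear ℕ._≟_ (replaceColumn L column-d M) (replaceColumn L rest M) _ L (w d) (+ 1)
             (agree-off-L _ column-d) (agree-off-L _ rest) column-L rs cs once ⟩
      w d * detOn (replaceColumn L column-d M) rs cs + + 1 * detOn (replaceColumn L rest M) rs cs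
        ≡⟨ cong (λ t → w d * detOn (replaceColumn L column-d M) rs cs + t)
             (trans (*-identityˡ _) (detOn-replaceColumn-sum ds w)) ⟩
      w d * detOn (replaceColumn L column-d M) rs cs
        + sumOver ds (λ d′ → w d′ * detOn (replaceColumn L (λ r → M r d′) M) rs cs) ∎
      where
      column-d rest : R → ℤ
      column-d r = M r d
      rest r = sumOver ds (λ d′ → w d′ * M r d′)
      column-L : ∀ r → replaceColumn L (λ r → w d * column-d r + rest r) M r L
                     ≡ w d * replaceColumn L column-d M r L + + 1 * replaceColumn L rest M r L
      column-L r = begin
        replaceColumn L (λ r → w d * column-d r + rest r) M r L
          ≡⟨ replaceColumn-≡ L (λ r → w d * column-d r + rest r) M r ⟩
        w d * column-d r + rest r
          ≡⟨ cong₂ (λ u v → w d * u + v) (sym (replaceColumn-≡ L column-d M r))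
               (trans (sym (replaceColumn-≡ L rest M r)) (sym (*-identityˡ _))) ⟩
        w d * replaceColumn L column-d M r L + + 1 * replaceColumn L rest M r L ∎

  replaceColumn-self : ∀ L (M : R → ℕ → ℤ) r c → replaceColumn L (λ r → M r L) M r c ≡ M r c
  replaceColumn-self L M r c with c ℕ.≟ L
  ... | yes refl = replaceColumn-≡ L (λ r → M r L) M r
  ... | no c≢L = replaceColumn-≢ (λ r → M r L) M r c≢L

  detOn-replaceColumn-repeated : ∀ (M : R → ℕ → ℤ) L rs d → d < L →
    detOn (replaceColumn L (λ r → M r d) M) rs (interval 0 (suc L)) ≡ + 0
  detOn-replaceColumn-repeated M L rs d d<L = begin
    detOn (replaceColumn L (λ r → M r d) M) rs (interval 0 (suc L))
      ≡⟨ detOn-cong _ (λ r c → M r (redirect c)) rs _ (λ r c _ _ → redirected r c) ⟩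
    detOn (λ r c → M r (redirect c)) rs (interval 0 (suc L))
      ≡⟨ sym (detOn-map M id redirect rs (interval 0 (suc L))) ⟩
    detOn M (map id rs) (map redirect (interval 0 (suc L)))
      ≡⟨ cong₂ (detOn M) (map-id rs) (trans (cong (map redirect) (interval-snoc 0 L)) (map-++ redirect (interval 0 L) (L ∷ []))) ⟩
    detOn M rs (map redirect (interval 0 L) ++ redirect L ∷ [])
      ≡⟨ cong (λ x → detOn M rs (map redirect (interval 0 L) ++ x ∷ [])) redirect-L ⟩
    detOn M rs (map redirect (interval 0 L) ++ d ∷ [])
      ≡⟨ detOn-repeated M rs [] (subst (_∈ map redirect (interval 0 L)) redirect-d (∈-map⁺ redirect (∈-interval⁺ 0 L z≤n d<L))) ⟩
    + 0 ∎
    where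
    redirect : ℕ → ℕ
    redirect c = if c ℕ.≡ᵇ L then d else c
    redirected : ∀ r c → replaceColumn L (λ r → M r d) M r c ≡ M r (redirect c)
    redirected r c with c ℕ.≡ᵇ L
    ... | true = refl
    ... | false = refl
    redirect-L : redirect L ≡ d
    redirect-L rewrite ≡ᵇ-refl L = refl
    redirect-d : redirect d ≡ d
    redirect-d rewrite ≢⇒≡ᵇ≡false (<⇒≢ d<L) = refl

  -- Every summand of the expansion by linearity, except the one for column L, has a repeated column.
  detOn-replaceLastColumn : ∀ (M : R → ℕ → ℤ) (w : ℕ → ℤ) L rs →
    detOn (replaceColumn L (λ r → sumOver (interval 0 (suc L)) (λ d → w d * M r d)) M) rs (interval 0 (suc L))
      ≡ w L * detOn M rs (interval 0 (suc L))
  detOn-replaceLastColumn M w L rs = begin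
    detOn (replaceColumn L (λ r → sumOver cs (λ d → w d * M r d)) M) rs cs
      ≡⟨ detOn-replaceColumn-sum M L rs cs (occurrences-interval 0 L) cs w ⟩
    sumOver cs term
      ≡⟨ cong (λ l → sumOver l term) (interval-snoc 0 L) ⟩
    sumOver (interval 0 L ++ L ∷ []) term
      ≡⟨ sumOver-++ (interval 0 L) (L ∷ []) term ⟩
    sumOver (interval 0 L) term + (term L + + 0)
      ≡⟨ cong₂ (λ u v → u + (w L * v + + 0))
           (sumOver-zero (interval 0 L) (λ d d∈ → trans (cong (w d *_) (detOn-replaceColumn-repeated M L rs d (∈-interval⁻ 0 L d∈)))
                                                         (*-zeroʳ (w d))))
           (detOn-cong _ M rs cs (λ r c _ _ → replaceColumn-self L M r c)) ⟩
    + 0 + (w L * detOn M rs cs + + 0)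
      ≡⟨ trans (+-identityˡ _) (+-identityʳ _) ⟩
    w L * detOn M rs cs ∎
    where
    cs : List ℕ
    cs = interval 0 (suc L)
    term : ℕ → ℤ
    term d = w d * detOn (replaceColumn L (λ r → M r d) M) rs cs

  detOn-columnCombination : ∀ (M : R → ℕ → ℤ) (w : ℕ → ℤ) L rs k (u : R → ℤ) →
    (∀ r → r ∈ rs → sumOver (interval 0 (suc L)) (λ d → w d * M r d) ≡ k * u r) →
    w L * detOn M rs (interval 0 (suc L)) ≡ k * detOn (replaceColumn L u M) rs (interval 0 (suc L))
  detOn-columnCombination M w L rs k u combination = begin
    w L * detOn M rs cs
      ≡⟨ sym (detOn-replaceLastColumn M w L rs) ⟩
    detOn (replaceColumn L (λ r → sumOver cs (λ d → w d * M r d)) M) rs cs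
      ≡⟨ detOn-cong _ _ rs cs (λ r c r∈ _ → cong (λ x → if c ℕ.≡ᵇ L then x else M r c) (combination r r∈)) ⟩
    detOn (replaceColumn L (λ r → k * u r) M) rs cs
      ≡⟨ detOn-replaceColumn-* M L rs cs (occurrences-interval 0 L) k u ⟩
    k * detOn (replaceColumn L u M) rs cs ∎
    where
    cs : List ℕ
    cs = interval 0 (suc L)

module Parity where
  open import Data.Bool.Properties using (not-involutive)

  double : ℕ → ℕ
  double zero = zero
  double (suc n) = suc (suc (double n))

  double-+ : ∀ a b → double (a ℕ.+ b) ≡ double a ℕ.+ double b
  double-+ zero b = refl
  double-+ (suc a) b = cong (λ n → suc (suc n)) (double-+ a b)

  double≡2* : ∀ n → double n ≡ 2 ℕ.* n
  double≡2* zero = refl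
  double≡2* (suc n) = cong suc (trans (cong suc (double≡2* n)) (sym (ℕₚ.+-suc n (n ℕ.+ 0))))

  n≤double : ∀ n → n ≤ double n
  n≤double zero = z≤n
  n≤double (suc n) = s≤s (ℕₚ.≤-trans (n≤double n) (ℕₚ.n≤1+n _))

  double≢suc-double : ∀ x o → double x ≢ suc (double o)
  double≢suc-double zero o ()
  double≢suc-double (suc x) zero ()
  double≢suc-double (suc x) (suc o) eq = double≢suc-double x o (suc-injective (suc-injective eq))

  isOdd : ℕ → Bool
  isOdd zero = false
  isOdd (suc n) = not (isOdd n)

  isOdd-+ : ∀ a b → isOdd (a ℕ.+ b) ≡ isOdd a xor isOdd b
  isOdd-+ zero b = refl
  isOdd-+ (suc a) b rewrite isOdd-+ a b with isOdd a | isOdd b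
  ... | true | true = refl
  ... | true | false = refl
  ... | false | true = refl
  ... | false | false = refl

  isOdd-double : ∀ k → isOdd (double k) ≡ false
  isOdd-double zero = refl
  isOdd-double (suc k) rewrite isOdd-double k = refl

  isOdd-suc-double : ∀ k → isOdd (suc (double k)) ≡ true
  isOdd-suc-double k = cong not (isOdd-double k)

  isOdd-double-+ : ∀ m r → isOdd (double m ℕ.+ r) ≡ isOdd r
  isOdd-double-+ zero r = refl
  isOdd-double-+ (suc m) r = trans (not-involutive _) (isOdd-double-+ m r)

  isOdd⇒≡suc-double : ∀ n → isOdd n ≡ true → ∃ λ k → n ≡ suc (double k)
  isOdd⇒≡suc-double zero ()
  isOdd⇒≡suc-double (suc zero) _ = 0 , refl
  isOdd⇒≡suc-double (suc (suc n)) odd with isOdd⇒≡suc-double n (trans (sym (not-involutive (isOdd n))) odd)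
  ... | k , refl = suc k , refl

  ¬isOdd⇒≡double : ∀ n → isOdd n ≡ false → ∃ λ k → n ≡ double k
  ¬isOdd⇒≡double zero _ = 0 , refl
  ¬isOdd⇒≡double (suc zero) ()
  ¬isOdd⇒≡double (suc (suc n)) even with ¬isOdd⇒≡double n (trans (sym (not-involutive (isOdd n))) even)
  ... | k , refl = suc k , refl

module Sylvester where
  open Determinant
  open Parity
  open import Data.Integer using (ℤ; +_; _*_)
  open import Data.Integer.Properties using (*-identityˡ)
  open import Data.Nat using (_+_; _∸_; _<ᵇ_; _≡ᵇ_)
  open import Data.Nat.Properties using (+-identityʳ; +-suc; +-assoc; m∸n+n≡m; m+[n∸m]≡n; <⇒<ᵇ; <ᵇ⇒<; ≮⇒≥; <⇒≱)
  open ≡-Reasoning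

  -- sylvester n p n q of Defs, indexed by ℕ instead of Fin (n + n).
  sylvesterℕ : ℕ → (ℕ → ℤ) → (ℕ → ℤ) → ℕ → ℕ → ℤ
  sylvesterℕ n p q r c = if r <ᵇ n then shiftRow n p r c else shiftRow n q (r ∸ n) c

  tabulate-+toℕ : ∀ s n → tabulate {n = n} (λ i → s + toℕ i) ≡ interval s n
  tabulate-+toℕ s zero = refl
  tabulate-+toℕ s (suc n) = cong₂ _∷_ (+-identityʳ s)
    (trans (tabulate-cong (λ i → +-suc s (toℕ i))) (tabulate-+toℕ (suc s) n))

  resultant≡detOn : ∀ n p q →
    resultant n p n q ≡ detOn (sylvesterℕ n p q) (interval 0 (n + n)) (interval 0 (n + n))
  resultant≡detOn n p q = trans (det≡detOn (sylvesterℕ n p q) (n + n) toℕ toℕ)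
    (cong (λ l → detOn (sylvesterℕ n p q) l l) (tabulate-+toℕ 0 (n + n)))

  -- P is the coefficient function of p(x²).
  ComposedWithSquare : (ℕ → ℤ) → (ℕ → ℤ) → Set
  ComposedWithSquare P p = (∀ k → P (double k) ≡ p k) × (∀ k → P (suc (double k)) ≡ + 0)

  double-<ᵇ : ∀ a b → (double a <ᵇ double b) ≡ (a <ᵇ b)
  double-<ᵇ a zero = refl
  double-<ᵇ zero (suc b) = refl
  double-<ᵇ (suc a) (suc b) = double-<ᵇ a b

  suc-double-<ᵇ : ∀ a b → (suc (double a) <ᵇ double b) ≡ (a <ᵇ b)
  suc-double-<ᵇ a zero = refl
  suc-double-<ᵇ zero (suc b) = refl
  suc-double-<ᵇ (suc a) (suc b) = suc-double-<ᵇ a b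

  double-∸ : ∀ a b → double a ∸ double b ≡ double (a ∸ b)
  double-∸ a zero = refl
  double-∸ zero (suc b) = refl
  double-∸ (suc a) (suc b) = double-∸ a b

  suc-double-∸ : ∀ a b → b ≤ a → suc (double a) ∸ double b ≡ suc (double (a ∸ b))
  suc-double-∸ a zero _ = refl
  suc-double-∸ (suc a) (suc b) (s≤s b≤a) = suc-double-∸ a b b≤a

  double-≡ᵇ : ∀ a b → (double a ≡ᵇ double b) ≡ (a ≡ᵇ b)
  double-≡ᵇ zero zero = refl
  double-≡ᵇ zero (suc b) = refl
  double-≡ᵇ (suc a) zero = refl
  double-≡ᵇ (suc a) (suc b) = double-≡ᵇ a b

  suc-double-≡ᵇ-double : ∀ a b → (suc (double a) ≡ᵇ double b) ≡ false
  suc-double-≡ᵇ-double a zero = refl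
  suc-double-≡ᵇ-double zero (suc b) = refl
  suc-double-≡ᵇ-double (suc a) (suc b) = suc-double-≡ᵇ-double a b

  <ᵇ≡false⇒≥ : ∀ a b → (a <ᵇ b) ≡ false → b ≤ a
  <ᵇ≡false⇒≥ a b eq = ≮⇒≥ (λ a<b → subst T eq (<⇒<ᵇ a<b))

  ≥⇒<ᵇ≡false : ∀ {a b} → b ≤ a → (a <ᵇ b) ≡ false
  ≥⇒<ᵇ≡false {a} {b} b≤a with a <ᵇ b in a<b
  ... | true = ⊥-elim (<⇒≱ (<ᵇ⇒< a b (subst T (sym a<b) tt)) b≤a)
  ... | false = refl

  trinom-composedWithSquare : ∀ m a → ComposedWithSquare (trinom (double m) (double a)) (trinom m a)
  trinom-composedWithSquare m a = even , odd
    where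
    even : ∀ k → trinom (double m) (double a) (double k) ≡ trinom m a k
    even k rewrite double-≡ᵇ k m | double-≡ᵇ k a | double-≡ᵇ k 0 = refl
    odd : ∀ k → trinom (double m) (double a) (suc (double k)) ≡ + 0
    odd k rewrite suc-double-≡ᵇ-double k m | suc-double-≡ᵇ-double k a = refl

  shiftRow-double : ∀ {P p} → (∀ k → P (double k) ≡ p k) → ∀ d r c →
    shiftRow (double d) P (double r) (double c) ≡ shiftRow d p r c
  shiftRow-double P≡p d r c
    rewrite double-<ᵇ c r | double-∸ c r | double-<ᵇ d (c ∸ r) | double-∸ d (c ∸ r) | P≡p (d ∸ (c ∸ r)) = refl

  shiftRow-index : ∀ d (p : ℕ → ℤ) r c →
    shiftRow d p r c ≡ + 0 ⊎ ∃ λ k → k + c ≡ d + r × shiftRow d p r c ≡ p k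
  shiftRow-index d p r c with c <ᵇ r in c<r
  ... | true = inj₁ refl
  ... | false with d <ᵇ (c ∸ r) in d<c-r
  ... | true = inj₁ refl
  ... | false = inj₂ (d ∸ (c ∸ r) , index , refl)
    where
    index : d ∸ (c ∸ r) + c ≡ d + r
    index = begin
      d ∸ (c ∸ r) + c             ≡⟨ cong (λ t → d ∸ (c ∸ r) + t) (sym (m∸n+n≡m (<ᵇ≡false⇒≥ c r c<r))) ⟩
      d ∸ (c ∸ r) + (c ∸ r + r)   ≡⟨ sym (+-assoc (d ∸ (c ∸ r)) (c ∸ r) r) ⟩
      d ∸ (c ∸ r) + (c ∸ r) + r   ≡⟨ cong (_+ r) (m∸n+n≡m (<ᵇ≡false⇒≥ d (c ∸ r) d<c-r)) ⟩
      d + r ∎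

  -- Row and column indices of different parity meet only odd coefficients of P.
  shiftRow-parity-mismatch : ∀ m (P : ℕ → ℤ) → (∀ k → P (suc (double k)) ≡ + 0) →
    ∀ r c → isOdd r ≢ isOdd c → shiftRow (double m) P r c ≡ + 0
  shiftRow-parity-mismatch m P P-odd r c r≢c with shiftRow-index (double m) P r c
  ... | inj₁ vanishes = vanishes
  ... | inj₂ (k , index , entry) with isOdd k in k-parity
  ...   | true with isOdd⇒≡suc-double k k-parity
  ...     | k′ , refl = trans entry (P-odd k′)
  shiftRow-parity-mismatch m P P-odd r c r≢c | inj₂ (k , index , entry) | false = ⊥-elim (r≢c (begin
    isOdd r                   ≡⟨ sym (isOdd-double-+ m r) ⟩
    isOdd (double m + r)      ≡⟨ cong isOdd (sym index) ⟩
    isOdd (k + c)             ≡⟨ isOdd-+ k c ⟩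
    isOdd k xor isOdd c       ≡⟨ cong (_xor isOdd c) k-parity ⟩
    isOdd c ∎))

  module _ {P p Q q : ℕ → ℤ} (P∘x² : ComposedWithSquare P p) (Q∘x² : ComposedWithSquare Q q) where

    sylvesterℕ-double : ∀ m r c → sylvesterℕ (double m) P Q (double r) (double c) ≡ sylvesterℕ m p q r c
    sylvesterℕ-double m r c rewrite double-<ᵇ r m | double-∸ r m with r <ᵇ m
    ... | true = shiftRow-double {P} {p} (proj₁ P∘x²) m r c
    ... | false = shiftRow-double {Q} {q} (proj₁ Q∘x²) m (r ∸ m) c

    sylvesterℕ-suc-double : ∀ m r c →
      sylvesterℕ (double m) P Q (suc (double r)) (suc (double c)) ≡ sylvesterℕ m p q r c
    sylvesterℕ-suc-double m r c rewrite suc-double-<ᵇ r m with r <ᵇ m in r<m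
    ... | true = shiftRow-double {P} {p} (proj₁ P∘x²) m r c
    ... | false rewrite suc-double-∸ r m (<ᵇ≡false⇒≥ r m r<m) = shiftRow-double {Q} {q} (proj₁ Q∘x²) m (r ∸ m) c

    sylvesterℕ-parity-mismatch : ∀ m r c → isOdd r ≢ isOdd c → sylvesterℕ (double m) P Q r c ≡ + 0
    sylvesterℕ-parity-mismatch m r c r≢c with r <ᵇ double m in r<2m
    ... | true = shiftRow-parity-mismatch m P (proj₂ P∘x²) r c r≢c
    ... | false = shiftRow-parity-mismatch m Q (proj₂ Q∘x²) (r ∸ double m) c (λ eq → r≢c (trans (sym same-parity) eq))
      where
      same-parity : isOdd (r ∸ double m) ≡ isOdd r
      same-parity = begin
        isOdd (r ∸ double m)                ≡⟨ sym (isOdd-double-+ m (r ∸ double m)) ⟩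
        isOdd (double m + (r ∸ double m))   ≡⟨ cong isOdd (m+[n∸m]≡n (<ᵇ≡false⇒≥ r (double m) r<2m)) ⟩
        isOdd r ∎

    resultant-composedWithSquare : ∀ m → resultant (double m) P (double m) Q ≡ resultant m p m q * resultant m p m q
    resultant-composedWithSquare m = begin
      resultant (double m) P (double m) Q
        ≡⟨ resultant≡detOn (double m) P Q ⟩
      detOn S (interval 0 (double m + double m)) (interval 0 (double m + double m))
        ≡⟨ cong (λ l → detOn S l l) (cong (interval 0) (sym (double-+ m m))) ⟩
      detOn S cs cs
        ≡⟨ detOn-blockDiagonal S isOdd isOdd
             (λ r c r-odd c-even → mismatch r c (≡true∧≡false⇒≢ r-odd c-even))
             (λ r c r-even c-odd → mismatch r c (≢-sym (≡true∧≡false⇒≢ c-odd r-even))) cs cs (refl , refl) ⟩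
      shuffleSign cs * shuffleSign cs * (detOn S (part₀ cs) (part₀ cs) * detOn S (part₁ cs) (part₁ cs))
        ≡⟨ cong (_* (detOn S (part₀ cs) (part₀ cs) * detOn S (part₁ cs) (part₁ cs))) (sgn-square (inversions cs)) ⟩
      + 1 * (detOn S (part₀ cs) (part₀ cs) * detOn S (part₁ cs) (part₁ cs))
        ≡⟨ *-identityˡ _ ⟩
      detOn S (part₀ cs) (part₀ cs) * detOn S (part₁ cs) (part₁ cs)
        ≡⟨ cong₂ (λ l l′ → detOn S l l * detOn S l′ l′) (part₀-interval 0 (m + m)) (part₁-interval 0 (m + m)) ⟩
      detOn S (map double ks) (map double ks) * detOn S (map (suc ∘ double) ks) (map (suc ∘ double) ks)
        ≡⟨ cong₂ _*_
             (trans (detOn-map S double double ks ks) (detOn-cong _ _ ks ks (λ r c _ _ → sylvesterℕ-double m r c)))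
             (trans (detOn-map S _ _ ks ks) (detOn-cong _ _ ks ks (λ r c _ _ → sylvesterℕ-suc-double m r c))) ⟩
      detOn (sylvesterℕ m p q) ks ks * detOn (sylvesterℕ m p q) ks ks
        ≡⟨ sym (cong₂ _*_ (resultant≡detOn m p q) (resultant≡detOn m p q)) ⟩
      resultant m p m q * resultant m p m q ∎
      where
      open Colouring isOdd
      S : ℕ → ℕ → ℤ
      S = sylvesterℕ (double m) P Q
      cs ks : List ℕ
      cs = interval 0 (double (m + m))
      ks = interval 0 (m + m)
      mismatch : ∀ r c → isOdd r ≢ isOdd c → S r c ≡ + 0
      mismatch = sylvesterℕ-parity-mismatch m
      ≡true∧≡false⇒≢ : ∀ {a b} → a ≡ true → b ≡ false → a ≢ b
      ≡true∧≡false⇒≢ refl refl ()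
      part₀-interval : ∀ s k → part₀ (interval (double s) (double k)) ≡ map double (interval s k)
      part₀-interval s zero = refl
      part₀-interval s (suc k) rewrite isOdd-double s = cong (double s ∷_) (part₀-interval (suc s) k)
      part₁-interval : ∀ s k → part₁ (interval (double s) (double k)) ≡ map (suc ∘ double) (interval s k)
      part₁-interval s zero = refl
      part₁-interval s (suc k) rewrite isOdd-double s = cong (suc (double s) ∷_) (part₁-interval (suc s) k)

module Trinomials where
  open Determinant
  open Parity
  open Sylvester
  open import Data.Bool.Properties using (xor-assoc; xor-same; xor-identityʳ)
  open import Data.Integer using (ℤ; +_; -_; _+_; _-_; _*_)
  open import Data.Integer.Properties using (neg-involutive; *-identityˡ; *-identityʳ; *-assoc; *-zeroʳ; +-identityʳ; +-identityˡ)
  open import Data.Integer.Tactic.RingSolver using (solve-∀)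
  open import Data.Nat using (_∸_; _<ᵇ_)
  open import Data.Nat.Properties
    using (<ᵇ⇒<; m≤m+n; m+n∸m≡n; m∸n≤m; m∸[m∸n]≡n; +-∸-assoc; m∸n+n≡m; +-monoˡ-<; +-mono-<-≤; ≤-trans; ≤-refl; ≤-reflexive; n≤1+n; <⇒≱; ∸-monoˡ-<; n∸n≡0)
    renaming (+-comm to ℕ+-comm)
  open ≡-Reasoning

  δ-refl : ∀ a → δ a a ≡ + 1
  δ-refl zero = refl
  δ-refl (suc a) = δ-refl a

  δ-≢ : ∀ {a b} → a ≢ b → δ a b ≡ + 0
  δ-≢ {zero} {zero} a≢b = ⊥-elim (a≢b refl)
  δ-≢ {zero} {suc b} _ = refl
  δ-≢ {suc a} {zero} _ = refl
  δ-≢ {suc a} {suc b} a≢b = δ-≢ (λ a≡b → a≢b (cong suc a≡b))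

  sumOver-δ-below : ∀ (f : ℕ → ℤ) s T a → a < s → sumOver (interval s T) (λ c → f c * δ c a) ≡ + 0
  sumOver-δ-below f s zero a a<s = refl
  sumOver-δ-below f s (suc T) a a<s = begin
    f s * δ s a + sumOver (interval (suc s) T) (λ c → f c * δ c a)
      ≡⟨ cong₂ (λ u v → f s * u + v) (δ-≢ (λ s≡a → <⇒≱ a<s (≤-reflexive s≡a)))
           (sumOver-δ-below f (suc s) T a (≤-trans a<s (n≤1+n s))) ⟩
    f s * + 0 + + 0
      ≡⟨ cong (_+ + 0) (*-zeroʳ (f s)) ⟩
    + 0 ∎

  sumOver-δ : ∀ (f : ℕ → ℤ) s T a → s ≤ a → a < s ℕ.+ T → sumOver (interval s T) (λ c → f c * δ c a) ≡ f a
  sumOver-δ f s zero a s≤a a<s+0 = ⊥-elim (<⇒≱ (subst (a <_) (ℕₚ.+-identityʳ s) a<s+0) s≤a)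
  sumOver-δ f s (suc T) a s≤a a<s+T with s ℕ.≟ a
  ... | yes refl = begin
    f s * δ s s + sumOver (interval (suc s) T) (λ c → f c * δ c s)
      ≡⟨ cong₂ (λ u v → f s * u + v) (δ-refl s) (sumOver-δ-below f (suc s) T s ≤-refl) ⟩
    f s * + 1 + + 0
      ≡⟨ trans (+-identityʳ _) (*-identityʳ (f s)) ⟩
    f s ∎
  ... | no s≢a = begin
    f s * δ s a + sumOver (interval (suc s) T) (λ c → f c * δ c a)
      ≡⟨ cong₂ (λ u v → f s * u + v) (δ-≢ s≢a) (sumOver-δ f (suc s) T a (≤∧≢⇒< s≤a s≢a) (subst (a <_) (ℕₚ.+-suc s T) a<s+T)) ⟩
    f s * + 0 + f a
      ≡⟨ trans (cong (_+ f a) (*-zeroʳ (f s))) (+-identityˡ (f a)) ⟩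
    f a ∎

  shiftRow-at : ∀ d (p : ℕ → ℤ) r i → i ≤ d → shiftRow d p r (r ℕ.+ (d ∸ i)) ≡ p i
  shiftRow-at d p r i i≤d
    rewrite ≥⇒<ᵇ≡false (m≤m+n r (d ∸ i)) | m+n∸m≡n r (d ∸ i) | ≥⇒<ᵇ≡false (m∸n≤m d i) | m∸[m∸n]≡n i≤d = refl

  shiftRow-δ : ∀ N j s c → j ≤ N → shiftRow N (λ x → δ x j) s c ≡ δ c (s ℕ.+ (N ∸ j))
  shiftRow-δ N j s c j≤N with c ℕ.≟ s ℕ.+ (N ∸ j)
  ... | yes refl = trans (shiftRow-at N (λ x → δ x j) s j j≤N) (trans (δ-refl j) (sym (δ-refl c)))
  ... | no c≢ with shiftRow-index N (λ x → δ x j) s c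
  ...   | inj₁ vanishes = trans vanishes (sym (δ-≢ c≢))
  ...   | inj₂ (k , k+c≡N+s , entry) = trans entry (trans (δ-≢ k≢j) (sym (δ-≢ c≢)))
    where
    k≢j : k ≢ j
    k≢j refl = c≢ (begin
      c                    ≡⟨ sym (m+n∸m≡n k c) ⟩
      k ℕ.+ c ∸ k          ≡⟨ cong (_∸ k) (trans k+c≡N+s (ℕ+-comm N s)) ⟩
      s ℕ.+ N ∸ k          ≡⟨ +-∸-assoc s j≤N ⟩
      s ℕ.+ (N ∸ k) ∎)

  shiftRow-trinom : ∀ N k s c → shiftRow N (trinom N k) s c
    ≡ shiftRow N (λ x → δ x N) s c - shiftRow N (λ x → δ x k) s c + shiftRow N (λ x → δ x 0) s c
  shiftRow-trinom N k s c with c <ᵇ s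
  ... | true = refl
  ... | false with N <ᵇ (c ∸ s)
  ...   | true = refl
  ...   | false = refl

  -- The three nonzero entries of the row sit in columns s, s + (N - k) and s + N.
  trinom-rowSum : ∀ N k s → k ≤ N → s < N →
    sumOver (interval 0 (N ℕ.+ N)) (λ c → sgn c * shiftRow N (trinom N k) s c)
      ≡ sgn s - sgn (s ℕ.+ (N ∸ k)) + sgn (s ℕ.+ N)
  trinom-rowSum N k s k≤N s<N = begin
    Σ (λ c → sgn c * shiftRow N (trinom N k) s c)
      ≡⟨ sumOver-cong cs (λ c _ → entry c) ⟩
    Σ (λ c → sgn c * δ c s + - (sgn c * δ c a) + sgn c * δ c b)
      ≡⟨ sumOver-+ cs _ _ ⟩
    Σ (λ c → sgn c * δ c s + - (sgn c * δ c a)) + Σ (λ c → sgn c * δ c b)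
      ≡⟨ cong (_+ Σ (λ c → sgn c * δ c b)) (trans (sumOver-+ cs _ _) (cong (λ t → Σ (λ c → sgn c * δ c s) + t) (sumOver-neg cs _))) ⟩
    Σ (λ c → sgn c * δ c s) - Σ (λ c → sgn c * δ c a) + Σ (λ c → sgn c * δ c b)
      ≡⟨ cong₂ _+_ (cong₂ _-_ (sumOver-δ sgn 0 (N ℕ.+ N) s z≤n (≤-trans s<N (m≤m+n N N)))
                               (sumOver-δ sgn 0 (N ℕ.+ N) a z≤n (+-mono-<-≤ s<N (m∸n≤m N k))))
                   (sumOver-δ sgn 0 (N ℕ.+ N) b z≤n (+-monoˡ-< N s<N)) ⟩
    sgn s - sgn a + sgn b ∎
    where
    cs : List ℕ
    cs = interval 0 (N ℕ.+ N)
    a b : ℕ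
    a = s ℕ.+ (N ∸ k)
    b = s ℕ.+ N
    Σ : (ℕ → ℤ) → ℤ
    Σ = sumOver cs
    distribute : ∀ g x y z → g * (x - y + z) ≡ g * x + - (g * y) + g * z
    distribute = solve-∀
    entry : ∀ c → sgn c * shiftRow N (trinom N k) s c ≡ sgn c * δ c s + - (sgn c * δ c a) + sgn c * δ c b
    entry c = begin
      sgn c * shiftRow N (trinom N k) s c
        ≡⟨ cong (sgn c *_) (shiftRow-trinom N k s c) ⟩
      sgn c * (shiftRow N (λ x → δ x N) s c - shiftRow N (λ x → δ x k) s c + shiftRow N (λ x → δ x 0) s c)
        ≡⟨ cong (sgn c *_) (cong₂ _+_ (cong₂ _-_ coefficient-N (shiftRow-δ N k s c k≤N)) (shiftRow-δ N 0 s c z≤n)) ⟩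
      sgn c * (δ c s - δ c a + δ c b)
        ≡⟨ distribute (sgn c) _ _ _ ⟩
      sgn c * δ c s + - (sgn c * δ c a) + sgn c * δ c b ∎
      where
      coefficient-N : shiftRow N (λ x → δ x N) s c ≡ δ c s
      coefficient-N = trans (shiftRow-δ N N s c ≤-refl)
                            (cong (δ c) (trans (cong (s ℕ.+_) (n∸n≡0 N)) (ℕₚ.+-identityʳ s)))

  sgn-double : ∀ k → sgn (double k) ≡ + 1
  sgn-double zero = refl
  sgn-double (suc k) = trans (neg-involutive _) (sgn-double k)

  sgn-even : ∀ n → isOdd n ≡ false → sgn n ≡ + 1
  sgn-even n even with ¬isOdd⇒≡double n even
  ... | k , refl = sgn-double k

  sgn-odd : ∀ n → isOdd n ≡ true → sgn n ≡ - + 1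
  sgn-odd n odd with isOdd⇒≡suc-double n odd
  ... | k , refl = cong -_ (sgn-double k)

  isOdd-∸ : ∀ N k → k ≤ N → isOdd (N ∸ k) ≡ isOdd N xor isOdd k
  isOdd-∸ N k k≤N = sym (begin
    isOdd N xor isOdd k                        ≡⟨ cong (_xor isOdd k) (trans (cong isOdd (sym (m∸n+n≡m k≤N))) (isOdd-+ (N ∸ k) k)) ⟩
    (isOdd (N ∸ k) xor isOdd k) xor isOdd k    ≡⟨ xor-assoc (isOdd (N ∸ k)) (isOdd k) (isOdd k) ⟩
    isOdd (N ∸ k) xor (isOdd k xor isOdd k)    ≡⟨ cong (isOdd (N ∸ k) xor_) (xor-same (isOdd k)) ⟩
    isOdd (N ∸ k) xor false                    ≡⟨ xor-identityʳ (isOdd (N ∸ k)) ⟩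
    isOdd (N ∸ k) ∎)

  -- For N even and k odd, x^N - x^k + 1 takes the value 3 at x = -1.
  trinom-rowSum-3 : ∀ N k s → isOdd N ≡ false → isOdd k ≡ true → k ≤ N → s < N →
    sumOver (interval 0 (N ℕ.+ N)) (λ c → sgn c * shiftRow N (trinom N k) s c) ≡ + 3 * sgn s
  trinom-rowSum-3 N k s N-even k-odd k≤N s<N = begin
    sumOver (interval 0 (N ℕ.+ N)) (λ c → sgn c * shiftRow N (trinom N k) s c)
      ≡⟨ trinom-rowSum N k s k≤N s<N ⟩
    sgn s - sgn (s ℕ.+ (N ∸ k)) + sgn (s ℕ.+ N)
      ≡⟨ cong₂ (λ u v → sgn s - u + v)
           (trans (sgn-+ s (N ∸ k)) (cong (sgn s *_) (sgn-odd (N ∸ k) (trans (isOdd-∸ N k k≤N) (cong₂ _xor_ N-even k-odd)))))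
           (trans (sgn-+ s N) (cong (sgn s *_) (sgn-even N N-even))) ⟩
    sgn s - sgn s * - + 1 + sgn s * + 1
      ≡⟨ three-times (sgn s) ⟩
    + 3 * sgn s ∎
    where
    three-times : ∀ x → x - x * - + 1 + x * + 1 ≡ + 3 * x
    three-times = solve-∀

  sylvesterℕ-rowSum-3 : ∀ N k l r → isOdd N ≡ false → isOdd k ≡ true → isOdd l ≡ true → k ≤ N → l ≤ N →
    r < N ℕ.+ N →
    sumOver (interval 0 (N ℕ.+ N)) (λ c → sgn c * sylvesterℕ N (trinom N k) (trinom N l) r c) ≡ + 3 * sgn r
  sylvesterℕ-rowSum-3 N k l r N-even k-odd l-odd k≤N l≤N r<2N with r <ᵇ N in r<N
  ... | true = trinom-rowSum-3 N k r N-even k-odd k≤N (<ᵇ⇒< r N (subst T (sym r<N) tt))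
  ... | false = trans (trinom-rowSum-3 N l (r ∸ N) N-even l-odd l≤N r-N<N) (cong (+ 3 *_) (sym same-sign))
    where
    N≤r : N ≤ r
    N≤r = <ᵇ≡false⇒≥ r N r<N
    r-N<N : r ∸ N < N
    r-N<N = subst (r ∸ N <_) (m+n∸m≡n N N) (∸-monoˡ-< r<2N N≤r)
    same-sign : sgn r ≡ sgn (r ∸ N)
    same-sign = begin
      sgn r                         ≡⟨ cong sgn (sym (m∸n+n≡m N≤r)) ⟩
      sgn (r ∸ N ℕ.+ N)             ≡⟨ sgn-+ (r ∸ N) N ⟩
      sgn (r ∸ N) * sgn N           ≡⟨ cong (sgn (r ∸ N) *_) (sgn-even N N-even) ⟩
      sgn (r ∸ N) * + 1             ≡⟨ *-identityʳ _ ⟩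
      sgn (r ∸ N) ∎

  resultant-trinom-multipleOf3 : ∀ N k l → 0 < N → isOdd N ≡ false → isOdd k ≡ true → isOdd l ≡ true →
    k ≤ N → l ≤ N → ∃ λ X → resultant N (trinom N k) N (trinom N l) ≡ + 3 * X
  resultant-trinom-multipleOf3 (suc N′) k l _ N-even k-odd l-odd k≤N l≤N = sgn L * X , (begin
    resultant N P N Q                   ≡⟨ resultant≡detOn N P Q ⟩
    D                                   ≡⟨ sym (*-identityˡ D) ⟩
    + 1 * D                             ≡⟨ cong (_* D) (sym (sgn-square L)) ⟩
    sgn L * sgn L * D                   ≡⟨ *-assoc (sgn L) (sgn L) D ⟩
    sgn L * (sgn L * D)                 ≡⟨ cong (sgn L *_) multiple ⟩
    sgn L * (+ 3 * X)                   ≡⟨ swap-factors (sgn L) X ⟩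
    + 3 * (sgn L * X) ∎)
    where
    N L : ℕ
    N = suc N′
    L = N′ ℕ.+ N
    P Q : ℕ → ℤ
    P = trinom N k
    Q = trinom N l
    cs : List ℕ
    cs = interval 0 (N ℕ.+ N)
    D X : ℤ
    D = detOn (sylvesterℕ N P Q) cs cs
    X = detOn (replaceColumn L sgn (sylvesterℕ N P Q)) cs cs
    multiple : sgn L * D ≡ + 3 * X
    multiple = detOn-columnCombination (sylvesterℕ N P Q) sgn L cs (+ 3) sgn
      (λ r r∈ → sylvesterℕ-rowSum-3 N k l r N-even k-odd l-odd k≤N l≤N (∈-interval⁻ 0 (N ℕ.+ N) r∈))
    swap-factors : ∀ s x → s * (+ 3 * x) ≡ + 3 * (s * x)
    swap-factors = solve-∀

module Dyadic where
  open import Data.Integer using (ℤ; +_; -_; -[1+_]; _*_; ∣_∣)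
  open import Data.Integer.Properties as ℤₚ using (abs-*; ∣-i∣≡∣i∣)
  open import Data.Nat using (_^_) renaming (_*_ to _ℕ*_)
  open import Data.Nat.Properties using (*-comm; ^-distribˡ-+-*)
  open import Data.Nat.Divisibility using (_∣_; _∣?_; divides; ∣1⇒≡1; *-cancelˡ-∣)
  open import Data.Nat.Coprimality using (Coprime; coprime-divisor)
  open import Data.Nat.Primality using (prime[2]; prime⇒irreducible)
  open import Relation.Nullary.Decidable using (from-no)

  -- The body of DyadicallyResolve, so that DyadicallyResolve d p e q is Dyadic (resultant d p e q).
  Dyadic : ℤ → Set
  Dyadic x = ∃ λ (m : ℕ) → (x ≡ + (2 ^ m)) ⊎ (x ≡ - + (2 ^ m))

  odd⇒coprime-2 : ∀ {x} → ¬ 2 ∣ x → Coprime x 2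
  odd⇒coprime-2 2∤x (d∣x , d∣2) with prime⇒irreducible prime[2] d∣2
  ... | inj₁ d≡1 = d≡1
  ... | inj₂ refl = ⊥-elim (2∤x d∣x)

  ∣2^⇒≡2^ : ∀ M {x} → x ∣ 2 ^ M → ∃ λ m → x ≡ 2 ^ m
  ∣2^⇒≡2^ zero x∣1 = 0 , ∣1⇒≡1 x∣1
  ∣2^⇒≡2^ (suc M) {x} x∣2^1+M with 2 ∣? x
  ... | no 2∤x = ∣2^⇒≡2^ M (coprime-divisor (odd⇒coprime-2 2∤x) x∣2^1+M)
  ... | yes (divides y refl) with ∣2^⇒≡2^ M {y} (*-cancelˡ-∣ 2 (subst (_∣ 2 ^ suc M) (*-comm y 2) x∣2^1+M))
  ...   | m , refl = suc m , *-comm (2 ^ m) 2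

  dyadic⇒∣∣≡2^ : ∀ {x} → Dyadic x → ∃ λ m → ∣ x ∣ ≡ 2 ^ m
  dyadic⇒∣∣≡2^ (m , inj₁ refl) = m , refl
  dyadic⇒∣∣≡2^ (m , inj₂ refl) = m , ∣-i∣≡∣i∣ (+ (2 ^ m))

  ∣∣≡2^⇒dyadic : ∀ x m → ∣ x ∣ ≡ 2 ^ m → Dyadic x
  ∣∣≡2^⇒dyadic (+ n) m eq = m , inj₁ (cong +_ eq)
  ∣∣≡2^⇒dyadic -[1+ n ] m eq = m , inj₂ (cong (λ k → - + k) eq)

  dyadic-* : ∀ {a b} → Dyadic a → Dyadic b → Dyadic (a * b)
  dyadic-* {a} {b} da db with dyadic⇒∣∣≡2^ da | dyadic⇒∣∣≡2^ db
  ... | m , ∣a∣≡ | m′ , ∣b∣≡ = ∣∣≡2^⇒dyadic (a * b) (m ℕ.+ m′)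
    (trans (abs-* a b) (trans (cong₂ _ℕ*_ ∣a∣≡ ∣b∣≡) (sym (^-distribˡ-+-* 2 m m′))))

  dyadic-*⁻ʳ : ∀ a {b} → Dyadic (a * b) → Dyadic b
  dyadic-*⁻ʳ a {b} dab with dyadic⇒∣∣≡2^ dab
  ... | M , ∣ab∣≡ with ∣2^⇒≡2^ M (divides ∣ a ∣ (trans (sym ∣ab∣≡) (abs-* a b)))
  ...   | m , ∣b∣≡ = ∣∣≡2^⇒dyadic b m ∣b∣≡

  Dyadic-resp-≡ : ∀ {x y} → x ≡ y → Dyadic x ⇔ Dyadic y
  Dyadic-resp-≡ refl = mk⇔ id id

  dyadic-square : ∀ a → Dyadic (a * a) ⇔ Dyadic a
  dyadic-square a = mk⇔ (dyadic-*⁻ʳ a) (λ da → dyadic-* da da)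

  ¬dyadic-3* : ∀ x → ¬ Dyadic (+ 3 * x)
  ¬dyadic-3* x d3x with dyadic⇒∣∣≡2^ (dyadic-*⁻ʳ x (subst Dyadic (ℤₚ.*-comm (+ 3) x) d3x))
  ... | zero , ()
  ... | suc m , 3≡2^1+m = from-no (2 ∣? 3) (divides (2 ^ m) (trans 3≡2^1+m (*-comm 2 (2 ^ m))))

-- The graph T(n)

open Parity
open Sylvester using (resultant-composedWithSquare; trinom-composedWithSquare)
open Trinomials using (resultant-trinom-multipleOf3)
open Dyadic
open import Data.Integer using (ℤ; +_) renaming (_*_ to _ℤ*_)
open import Data.Nat using (_+_; _*_; _^_; _∸_; _%_)
open import Data.Nat.Properties
  using (*-assoc; *-comm; *-identityˡ; *-zeroʳ; +-suc; ^-distribˡ-+-*; *-cancelˡ-≡; *-cancelˡ-<; m^n≢0;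
         m+[n∸m]≡n; <⇒≤; <-≤-trans; ≮⇒≥; _<?_; <-irrefl)
open import Data.Nat.Tactic.RingSolver using (solve-∀)

trinomialResultant : ℕ → ℕ → ℕ → ℤ
trinomialResultant n i j = resultant n (trinom n i) n (trinom n j)

2^suc-* : ∀ a x → 2 ^ suc a * x ≡ double (2 ^ a * x)
2^suc-* a x = trans (*-assoc 2 (2 ^ a) x) (sym (double≡2* (2 ^ a * x)))

trinomialResultant-cong : ∀ {n n′ i i′ j j′} → n ≡ n′ → i ≡ i′ → j ≡ j′ →
  trinomialResultant n i j ≡ trinomialResultant n′ i′ j′
trinomialResultant-cong refl refl refl = refl

trinomialResultant-double : ∀ m a b →
  trinomialResultant (double m) (double a) (double b) ≡ trinomialResultant m a b ℤ* trinomialResultant m a b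
trinomialResultant-double m a b =
  resultant-composedWithSquare {trinom (double m) (double a)} {trinom m a} {trinom (double m) (double b)} {trinom m b}
    (trinom-composedWithSquare m a) (trinom-composedWithSquare m b) m

dyadic-trinomialResultant-2^* : ∀ v N i j →
  Dyadic (trinomialResultant (2 ^ v * N) (2 ^ v * i) (2 ^ v * j)) ⇔ Dyadic (trinomialResultant N i j)
dyadic-trinomialResultant-2^* zero N i j =
  Dyadic-resp-≡ (trinomialResultant-cong (*-identityˡ N) (*-identityˡ i) (*-identityˡ j))
dyadic-trinomialResultant-2^* (suc v) N i j =
  dyadic-trinomialResultant-2^* v N i j
    ⇔-∘ (dyadic-square (trinomialResultant (2 ^ v * N) (2 ^ v * i) (2 ^ v * j))
    ⇔-∘ Dyadic-resp-≡ (trans (trinomialResultant-cong (2^suc-* v N) (2^suc-* v i) (2^suc-* v j))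
                             (trinomialResultant-double (2 ^ v * N) (2 ^ v * i) (2 ^ v * j))))

Valuation₂ : ℕ → ℕ → Set
Valuation₂ a k = ∃ λ o → k ≡ 2 ^ a * suc (double o)

inClass⇔valuation₂ : ∀ a k → InClass (suc a) k ⇔ Valuation₂ a k
inClass⇔valuation₂ a k = mk⇔ (Product.map₂ (λ eq → trans eq (class-form a _)))
                               (Product.map₂ (λ eq → trans eq (sym (class-form a _))))
  where
  distribute : ∀ q t → q * (2 * t) + t ≡ t * suc (2 * q)
  distribute = solve-∀
  class-form : ∀ a q → q * 2 ^ suc a + 2 ^ a ≡ 2 ^ a * suc (double q)
  class-form a q = trans (distribute q (2 ^ a)) (cong (λ d → 2 ^ a * suc d) (sym (double≡2* q)))

valuation₂-exists : ∀ k → 0 < k → ∃ λ a → Valuation₂ a k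
valuation₂-exists = <-rec (λ k → 0 < k → ∃ λ a → Valuation₂ a k) step
  where
  step : ∀ k → (∀ {y} → y < k → 0 < y → ∃ λ a → Valuation₂ a y) → 0 < k → ∃ λ a → Valuation₂ a k
  step k smaller 0<k with isOdd k in parity
  ... | true with isOdd⇒≡suc-double k parity
  ...   | o , refl = 0 , o , sym (*-identityˡ _)
  step k smaller 0<k | false with ¬isOdd⇒≡double k parity
  ... | zero , refl = ⊥-elim (<-irrefl refl 0<k)
  ... | suc y , refl with smaller (s≤s (s≤s (n≤double y))) (s≤s z≤n)
  ...   | a , o , y+1≡ = suc a , o , trans (cong double y+1≡) (sym (2^suc-* a (suc (double o))))

2^-split : ∀ {a v} x → a < v → 2 ^ v * x ≡ 2 ^ a * (2 ^ suc (v ∸ suc a) * x)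
2^-split {a} {v} x a<v = begin
  2 ^ v * x                                      ≡⟨ cong (λ e → 2 ^ e * x) (sym (trans (+-suc a _) (m+[n∸m]≡n a<v))) ⟩
  2 ^ (a + suc (v ∸ suc a)) * x                  ≡⟨ cong (_* x) (^-distribˡ-+-* 2 a (suc (v ∸ suc a))) ⟩
  2 ^ a * 2 ^ suc (v ∸ suc a) * x                ≡⟨ *-assoc (2 ^ a) _ x ⟩
  2 ^ a * (2 ^ suc (v ∸ suc a) * x) ∎
  where open ≡-Reasoning

*-cancel-2^ : ∀ a {y z} → 2 ^ a * y ≡ 2 ^ a * z → y ≡ z
*-cancel-2^ a {y} {z} = *-cancelˡ-≡ y z (2 ^ a) {{m^n≢0 2 a}}

¬valuation₂-of-multiple : ∀ {a v} j → a < v → ¬ Valuation₂ a (2 ^ v * j)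
¬valuation₂-of-multiple {a} {v} j a<v (o , eq) = double≢suc-double (2 ^ (v ∸ suc a) * j) o (begin
  double (2 ^ (v ∸ suc a) * j)   ≡⟨ sym (2^suc-* (v ∸ suc a) j) ⟩
  2 ^ suc (v ∸ suc a) * j        ≡⟨ *-cancel-2^ a (trans (sym (2^-split j a<v)) eq) ⟩
  suc (double o) ∎)
  where open ≡-Reasoning

*-cancel-2^-< : ∀ a {y z} → 2 ^ a * y < 2 ^ a * z → y < z
*-cancel-2^-< a {y} {z} = *-cancelˡ-< (2 ^ a) y z

sameValuation⇒¬dyadic : ∀ {n v n₁ a k l} → n ≡ 2 ^ v * n₁ → a < v → Valuation₂ a k → Valuation₂ a l →
  k < n → l < n → ¬ Dyadic (trinomialResultant n k l)
sameValuation⇒¬dyadic {n} {v} {n₁} {a} n≡ a<v (o , refl) (o′ , refl) k<n l<n dyadic =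
  ¬dyadic-3* (proj₁ multipleOf3) (subst Dyadic (proj₂ multipleOf3) reduced)
  where
  N k′ l′ : ℕ
  N = 2 ^ suc (v ∸ suc a) * n₁
  k′ = suc (double o)
  l′ = suc (double o′)
  n≡2^aN : n ≡ 2 ^ a * N
  n≡2^aN = trans n≡ (2^-split n₁ a<v)
  N-even : isOdd N ≡ false
  N-even = trans (cong isOdd (2^suc-* (v ∸ suc a) n₁)) (isOdd-double (2 ^ (v ∸ suc a) * n₁))
  k′<N : k′ < N
  k′<N = *-cancel-2^-< a (subst (_ <_) n≡2^aN k<n)
  l′<N : l′ < N
  l′<N = *-cancel-2^-< a (subst (_ <_) n≡2^aN l<n)
  multipleOf3 : ∃ λ X → trinomialResultant N k′ l′ ≡ + 3 ℤ* X
  multipleOf3 = resultant-trinom-multipleOf3 N k′ l′ (<-≤-trans (s≤s z≤n) k′<N) N-even (isOdd-suc-double o) (isOdd-suc-double o′) (<⇒≤ k′<N) (<⇒≤ l′<N)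
  reduced : Dyadic (trinomialResultant N k′ l′)
  reduced = Equivalence.to (dyadic-trinomialResultant-2^* a N k′ l′)
              (subst Dyadic (trinomialResultant-cong n≡2^aN refl refl) dyadic)

inClass-independent : ∀ n v n₁ → n ≡ 2 ^ v * n₁ → (i k l : ℕ) → 1 ≤ i → i ≤ v →
  Vertex n k → Vertex n l → InClass i k → InClass i l → ¬ Adj n k l
inClass-independent n v n₁ n≡ (suc a) k l _ a<v (_ , k<n) (_ , l<n) k∈ l∈ (_ , dyadic) =
  sameValuation⇒¬dyadic n≡ a<v (Equivalence.to (inClass⇔valuation₂ a k) k∈) (Equivalence.to (inClass⇔valuation₂ a l) l∈) k<n l<n dyadic

outsideClasses⇔multiple : ∀ n v n₁ → n ≡ 2 ^ v * n₁ → (k : ℕ) → Vertex n k →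
  (((i : ℕ) → 1 ≤ i → i ≤ v → ¬ InClass i k) ⇔ ∃ (λ j → 0 < j × j < n₁ × k ≡ 2 ^ v * j))
outsideClasses⇔multiple n v n₁ n≡ k (1≤k , k<n) = mk⇔ outside⇒multiple multiple⇒outside
  where
  multiple⇒outside : ∃ (λ j → 0 < j × j < n₁ × k ≡ 2 ^ v * j) → (i : ℕ) → 1 ≤ i → i ≤ v → ¬ InClass i k
  multiple⇒outside (j , _ , _ , refl) (suc a) _ a<v k∈ =
    ¬valuation₂-of-multiple j a<v (Equivalence.to (inClass⇔valuation₂ a (2 ^ v * j)) k∈)
  outside⇒multiple : ((i : ℕ) → 1 ≤ i → i ≤ v → ¬ InClass i k) → ∃ (λ j → 0 < j × j < n₁ × k ≡ 2 ^ v * j)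
  outside⇒multiple outside with valuation₂-exists k 1≤k
  ... | a , valuation with a <? v
  ...   | yes a<v = ⊥-elim (outside (suc a) (s≤s z≤n) a<v (Equivalence.from (inClass⇔valuation₂ a k) valuation))
  ...   | no a≮v = j , 0<j , j<n₁ , k≡2^vj
    where
    j : ℕ
    j = 2 ^ (a ∸ v) * suc (double (proj₁ valuation))
    k≡2^vj : k ≡ 2 ^ v * j
    k≡2^vj = begin
      k                                                    ≡⟨ proj₂ valuation ⟩
      2 ^ a * suc (double (proj₁ valuation))               ≡⟨ cong (λ e → 2 ^ e * suc (double (proj₁ valuation))) (sym (m+[n∸m]≡n (≮⇒≥ a≮v))) ⟩
      2 ^ (v + (a ∸ v)) * suc (double (proj₁ valuation))   ≡⟨ cong (_* suc (double (proj₁ valuation))) (^-distribˡ-+-* 2 v (a ∸ v)) ⟩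
      2 ^ v * 2 ^ (a ∸ v) * suc (double (proj₁ valuation)) ≡⟨ *-assoc (2 ^ v) _ _ ⟩
      2 ^ v * j ∎
      where open ≡-Reasoning
    0<j : 0 < j
    0<j = *-cancel-2^-< v (subst₂ _<_ (sym (*-zeroʳ (2 ^ v))) k≡2^vj 1≤k)
    j<n₁ : j < n₁
    j<n₁ = *-cancel-2^-< v (subst₂ _<_ k≡2^vj n≡ k<n)

scaled-adjacency : ∀ n v n₁ → n ≡ 2 ^ v * n₁ → (j j′ : ℕ) → Adj n (2 ^ v * j) (2 ^ v * j′) ⇔ Adj n₁ j j′
scaled-adjacency .(2 ^ v * n₁) v n₁ refl j j′ = mk⇔
  (Product.map (λ ≢ j≡j′ → ≢ (cong (2 ^ v *_) j≡j′)) (Equivalence.to (dyadic-trinomialResultant-2^* v n₁ j j′)))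
  (Product.map (λ ≢ 2^vj≡2^vj′ → ≢ (*-cancel-2^ v 2^vj≡2^vj′)) (Equivalence.from (dyadic-trinomialResultant-2^* v n₁ j j′)))

mainTheorem9 : (n v n₁ : ℕ) → 0 < n → n ≡ 2 ^ v * n₁ → n₁ % 2 ≡ 1 →
    ((i k l : ℕ) → 1 ≤ i → i ≤ v → Vertex n k → Vertex n l →
      InClass i k → InClass i l → ¬ Adj n k l)
    × ((k : ℕ) → Vertex n k →
        (((i : ℕ) → 1 ≤ i → i ≤ v → ¬ InClass i k)
          ⇔ ∃ (λ j → 0 < j × j < n₁ × k ≡ 2 ^ v * j)))
    × ((j j' : ℕ) → 0 < j → j < n₁ → 0 < j' → j' < n₁ →
        (Adj n (2 ^ v * j) (2 ^ v * j') ⇔ Adj n₁ j j'))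
mainTheorem9 n v n₁ _ n≡ _ =
    inClass-independent n v n₁ n≡
  , outsideClasses⇔multiple n v n₁ n≡
  , λ j j′ _ _ _ _ → scaled-adjacency n v n₁ n≡ j j′
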